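{- Consider a collection $\mathcal{C}=\{A_1,\dots,A_t\}$ of finite sets, each of the form $\{1,2,\dots,|A_j|\}$ (consecutive integers), evolving under the operations: create (insert a 1-element set into $\mathcal{C}$), delete (remove a 1-element set from $\mathcal{C}$), merge$(A_j,A_{j'})$ (replace $A_j,A_{j'}$ by their concatenation $\{1,\dots,|A_j|+|A_{j'}|\}$, the elements of $A_{j'}$ following those of $A_j$), and split$(A_j,k)$ (replace $A_j$ by $\{1,\dots,k\}$ and $\{k+1,\dots,|A_j|\}$). There is a data structure that maintains a laminar near-perfect matching $M(A_j)$ of depth $O(\log|A_j|)$ for each set $A_j\in\mathcal{C}$, such that each merge$(A_j,A_{j'})$ operation modifies $O(\log(|A_j|+|A_{j'}|))$ edges and each split$(A_j,k)$ operation modifies $O(\log^2|A_j|)$ edges.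
   Context: A near-perfect matching on a set covers all but at most one of its elements. A set $E$ of edges on a subset of $\mathbb{R}$ (each edge $ab$ viewed as an interval) is laminar if there are no two edges $a_1b_1,a_2b_2$ with $a_1<a_2<b_1<b_2$; the depth of a laminar $E$ is the maximum number of pairwise overlapping edges of $E$ (the maximum length of a chain of properly nested intervals). -}

module Defs where

open import Level using (suc; zero)
open import Data.Nat using (ℕ; _+_; _*_; _∸_; _≤_; _<_)
open import Data.Nat.Properties using (_≟_)
open import Data.Nat.Logarithm using (⌊log₂_⌋)
open import Data.Product using (Σ; ∃; _×_; _,_; proj₁; proj₂)
open import Data.Product.Properties using (≡-dec)
open import Data.Sum using (_⊎_)
open import Data.List using (List; map; filter; length)
open import Data.List.Relation.Unary.All using (All)
open import Data.List.Relation.Unary.Any using (Any)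
open import Data.List.Relation.Unary.AllPairs using (AllPairs)
open import Data.List.Membership.Propositional using (_∈_)
open import Data.List.Relation.Binary.Subset.Propositional using (_⊆_)
open import Relation.Nullary using (¬_; ¬?)
open import Relation.Binary.PropositionalEquality using (_≡_; _≢_)
open import Relation.Binary.Definitions using (DecidableEquality)

Edge : Set
Edge = ℕ × ℕ

_≟ₑ_ : DecidableEquality Edge
_≟ₑ_ = ≡-dec _≟_ _≟_

open import Data.List.Membership.DecPropositional _≟ₑ_ using (_∈?_)

Disjoint : Edge → Edge → Set
Disjoint (a , b) (c , d) = a ≢ c × a ≢ d × b ≢ c × b ≢ d

IsMatching : ℕ → List Edge → Set
IsMatching n M = All (λ e → 1 ≤ proj₁ e × proj₁ e < proj₂ e × proj₂ e ≤ n) M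
               × AllPairs Disjoint M

Covered : ℕ → List Edge → Set
Covered v M = Any (λ e → v ≡ proj₁ e ⊎ v ≡ proj₂ e) M

NearPerfect : ℕ → List Edge → Set
NearPerfect n M = ∀ u v → 1 ≤ u → u ≤ n → 1 ≤ v → v ≤ n →
                  ¬ Covered u M → ¬ Covered v M → u ≡ v

Laminar : List Edge → Set
Laminar M = ∀ {e f} → e ∈ M → f ∈ M →
            ¬ (proj₁ e < proj₁ f × proj₁ f < proj₂ e × proj₂ e < proj₂ f)

Contains : Edge → Edge → Set
Contains (a , b) (c , d) = a < c × d < b

DepthAtMost : ℕ → List Edge → Set
DepthAtMost d M = ∀ (C : List Edge) → C ⊆ M → AllPairs Contains C → length C ≤ d

-- shift all edges by m (places a matching of A_{j'} after the |A_j| = m elements of A_j)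
shift : ℕ → List Edge → List Edge
shift m = map (λ e → (proj₁ e + m , proj₂ e + m))

modified : List Edge → List Edge → ℕ
modified M M' = length (filter (λ e → ¬? (e ∈? M')) M)
              + length (filter (λ e → ¬? (e ∈? M)) M')

_++ₘ_ : List Edge → List Edge → List Edge
_++ₘ_ = Data.List._++_

-- An abstract data structure maintaining one set A_j = {1,…,size s} per state s,
-- with the matching M(A_j) = matching s, and operations create / merge / split.
-- (delete of a 1-element set just discards a state and modifies no edges.)
record DataStructure : Set₁ where
  field
    State    : Set
    size     : State → ℕ
    matching : State → List Edge
    create   : State
    size-create : size create ≡ 1
    merge    : State → State → State
    size-merge : ∀ s t → size (merge s t) ≡ size s + size t
    split    : (s : State) (k : ℕ) → 1 ≤ k → k < size s → State × State
    size-split₁ : ∀ s k p q → size (proj₁ (split s k p q)) ≡ k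
    size-split₂ : ∀ s k p q → size (proj₂ (split s k p q)) ≡ size s ∸ k

-- the guarantees claimed, with constant c (O(f(n)) read as ≤ c * (1 + f-ish(n)))
Guarantees : DataStructure → ℕ → Set
Guarantees D c =
    (∀ s → IsMatching (size s) (matching s)
         × NearPerfect (size s) (matching s)
         × Laminar (matching s)
         × DepthAtMost (c * (1 + ⌊log₂ size s ⌋)) (matching s))
  × (∀ s t → modified (matching s ++ₘ shift (size s) (matching t)) (matching (merge s t))
              ≤ c * (1 + ⌊log₂ (size s + size t) ⌋))
  × (∀ s k p q →
       modified (matching s)
                (matching (proj₁ (split s k p q)) ++ₘ shift k (matching (proj₂ (split s k p q))))
         ≤ c * ((1 + ⌊log₂ size s ⌋) * (1 + ⌊log₂ size s ⌋)))
  where open DataStructure D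

-- Each set is stored as a 2-3 tree whose leaves are its elements. The matching of a tree is
-- built bottom-up: a node puts the matchings of its children side by side and joins the (at
-- most one) unmatched leaf of a child to that of the next by a bridge edge. An unmatched leaf
-- lies under no edge, so bridges keep the matching laminar, and every node adds at most two
-- levels of nesting, so the depth is at most twice the height, O(log n).
-- Merging joins two trees by descending the spine of the taller one; only bridges on that
-- spine change, O(log n) edges. Splitting descends one root-to-leaf path and joins the pieces
-- hanging off it, at most two joins per level, O(log² n) edges. Changes are tracked by
-- A ≈[ k ] B (each of A, B lies within the other plus k edges), which is stable under
-- concatenation and permutation.

module Submission where

open import Defs
open import Data.Nat
open import Data.Nat.Properties
open import Data.Nat.Tactic.RingSolver using (solve-∀)
open import Data.Nat.Logarithm using (⌊log₂_⌋; ⌊log₂⌋-mono-≤; ⌊log₂[2^n]⌋≡n)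
open import Data.Product using (Σ; ∃; _×_; _,_; proj₁; proj₂)
open import Data.Sum using (_⊎_; inj₁; inj₂; [_,_]′)
open import Data.Empty using (⊥-elim)
open import Data.List using (List; []; _∷_; _++_; length; filter)
open import Data.List.Properties using (length-++; map-++; ++-assoc)
open import Data.List.Relation.Unary.All as All using (All; []; _∷_)
open import Data.List.Relation.Unary.AllPairs as AllPairs using (AllPairs; []; _∷_)
import Data.List.Relation.Unary.AllPairs.Properties as AllPairsₚ
open import Data.List.Relation.Unary.Any using (here; there)
import Data.List.Relation.Unary.Any.Properties as Any
open import Data.List.Relation.Unary.Unique.Propositional using (Unique)
open import Data.List.Membership.Propositional using (_∈_; find; lose)
open import Data.List.Membership.Propositional.Properties
  using (∈-++⁺ˡ; ∈-++⁺ʳ; ∈-++⁻; ∈-∃++; ∈-filter⁻)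
open import Data.List.Membership.DecPropositional _≟ₑ_ using (_∈?_)
open import Data.List.Relation.Binary.Subset.Propositional using (_⊆_)
open import Data.List.Relation.Binary.Permutation.Propositional using (_↭_; ↭-refl; ↭-sym; ↭-reflexive)
open import Data.List.Relation.Binary.Permutation.Propositional.Properties
  using (∈-resp-↭; ++⁺ˡ; ++-commutativeMonoid)
open import Algebra.Solver.CommutativeMonoid (++-commutativeMonoid {A = Edge}) using (solve; _⊜_; _⊕_; id)
open import Relation.Binary.Definitions using (tri<; tri≈; tri>)
open import Relation.Nullary using (¬_; ¬?; yes; no)
open import Data.Maybe as Maybe using (Maybe; just; nothing)
open import Relation.Binary.PropositionalEquality
  using (_≡_; _≢_; refl; sym; trans; cong; cong₂; subst; module ≡-Reasoning)

-- Edge lists that differ in few edges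

unique-⊆⇒length≤ : ∀ {xs ys : List Edge} → Unique xs → xs ⊆ ys → length xs ≤ length ys
unique-⊆⇒length≤ {[]} _ _ = z≤n
unique-⊆⇒length≤ {x ∷ xs} {ys} (x∉xs ∷ uxs) xs⊆ys with ∈-∃++ (xs⊆ys (here refl))
... | pre , post , refl = begin
  suc (length xs)                ≤⟨ s≤s (unique-⊆⇒length≤ uxs xs⊆rest) ⟩
  suc (length (pre ++ post))     ≡⟨ cong suc (length-++ pre) ⟩
  suc (length pre + length post) ≡⟨ sym (+-suc (length pre) (length post)) ⟩
  length pre + length (x ∷ post) ≡⟨ sym (length-++ pre) ⟩
  length (pre ++ x ∷ post)       ∎
  where
  open ≤-Reasoning
  xs⊆rest : xs ⊆ pre ++ post
  xs⊆rest {y} y∈xs with ∈-++⁻ pre (xs⊆ys (there y∈xs))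
  ... | inj₁ y∈pre = ∈-++⁺ˡ y∈pre
  ... | inj₂ (here refl) = ⊥-elim (All.lookup x∉xs y∈xs refl)
  ... | inj₂ (there y∈post) = ∈-++⁺ʳ pre y∈post

infix 4 _⊆[_]_ _≈[_]_

_⊆[_]_ : List Edge → ℕ → List Edge → Set
A ⊆[ k ] B = ∃ λ X → length X ≤ k × A ⊆ X ++ B

_≈[_]_ : List Edge → ℕ → List Edge → Set
A ≈[ k ] B = A ⊆[ k ] B × B ⊆[ k ] A

length-filter-∉≤ : ∀ {A B X} → Unique A → A ⊆ X ++ B →
                   length (filter (λ e → ¬? (e ∈? B)) A) ≤ length X
length-filter-∉≤ {A} {B} {X} uA A⊆X++B =
  unique-⊆⇒length≤ (AllPairsₚ.filter⁺ _ uA) filtered⊆X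
  where
  filtered⊆X : filter (λ e → ¬? (e ∈? B)) A ⊆ X
  filtered⊆X e∈ with ∈-filter⁻ (λ e → ¬? (e ∈? B)) {xs = A} e∈
  ... | e∈A , e∉B = [ (λ e∈X → e∈X) , (λ e∈B → ⊥-elim (e∉B e∈B)) ]′ (∈-++⁻ X (A⊆X++B e∈A))

modified≤ : ∀ {A B k} → Unique A → Unique B → A ≈[ k ] B → modified A B ≤ k + k
modified≤ uA uB ((X , ∣X∣≤k , A⊆) , (Y , ∣Y∣≤k , B⊆)) =
  +-mono-≤ (≤-trans (length-filter-∉≤ uA A⊆) ∣X∣≤k) (≤-trans (length-filter-∉≤ uB B⊆) ∣Y∣≤k)

⊆[]-refl : ∀ {A} → A ⊆[ 0 ] A
⊆[]-refl = [] , z≤n , λ e∈ → e∈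

⊆[]-weaken : ∀ {A B k l} → k ≤ l → A ⊆[ k ] B → A ⊆[ l ] B
⊆[]-weaken k≤l (X , ∣X∣≤k , A⊆) = X , ≤-trans ∣X∣≤k k≤l , A⊆

⊆[]-trans : ∀ {A B C k l} → A ⊆[ k ] B → B ⊆[ l ] C → A ⊆[ k + l ] C
⊆[]-trans {C = C} (X , ∣X∣≤k , A⊆) (Y , ∣Y∣≤l , B⊆) =
  X ++ Y , ≤-trans (≤-reflexive (length-++ X)) (+-mono-≤ ∣X∣≤k ∣Y∣≤l) , A⊆X++Y++C
  where
  A⊆X++Y++C : _ ⊆ (X ++ Y) ++ C
  A⊆X++Y++C e∈ with ∈-++⁻ X (A⊆ e∈)
  ... | inj₁ e∈X = ∈-++⁺ˡ (∈-++⁺ˡ e∈X)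
  ... | inj₂ e∈B with ∈-++⁻ Y (B⊆ e∈B)
  ...   | inj₁ e∈Y = ∈-++⁺ˡ (∈-++⁺ʳ X e∈Y)
  ...   | inj₂ e∈C = ∈-++⁺ʳ (X ++ Y) e∈C

⊆[]-++ : ∀ {A B C D k l} → A ⊆[ k ] B → C ⊆[ l ] D → A ++ C ⊆[ k + l ] B ++ D
⊆[]-++ {A} {B} {C} {D} (X , ∣X∣≤k , A⊆) (Y , ∣Y∣≤l , C⊆) =
  X ++ Y , ≤-trans (≤-reflexive (length-++ X)) (+-mono-≤ ∣X∣≤k ∣Y∣≤l) , A++C⊆
  where
  A++C⊆ : A ++ C ⊆ (X ++ Y) ++ B ++ D
  A++C⊆ e∈ with ∈-++⁻ A e∈
  ... | inj₁ e∈A with ∈-++⁻ X (A⊆ e∈A)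
  ...   | inj₁ e∈X = ∈-++⁺ˡ (∈-++⁺ˡ e∈X)
  ...   | inj₂ e∈B = ∈-++⁺ʳ (X ++ Y) (∈-++⁺ˡ e∈B)
  A++C⊆ e∈ | inj₂ e∈C with ∈-++⁻ Y (C⊆ e∈C)
  ...   | inj₁ e∈Y = ∈-++⁺ˡ (∈-++⁺ʳ X e∈Y)
  ...   | inj₂ e∈D = ∈-++⁺ʳ (X ++ Y) (∈-++⁺ʳ B e∈D)

⊆[]-short : ∀ {A B k} → length A ≤ k → A ⊆[ k ] B
⊆[]-short {A} ∣A∣≤k = A , ∣A∣≤k , ∈-++⁺ˡ

≈-refl : ∀ {A} → A ≈[ 0 ] A
≈-refl = ⊆[]-refl , ⊆[]-refl

≈-sym : ∀ {A B k} → A ≈[ k ] B → B ≈[ k ] A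
≈-sym (A⊆ , B⊆) = B⊆ , A⊆

≈-weaken : ∀ {A B k l} → k ≤ l → A ≈[ k ] B → A ≈[ l ] B
≈-weaken k≤l (A⊆ , B⊆) = ⊆[]-weaken k≤l A⊆ , ⊆[]-weaken k≤l B⊆

≈-trans : ∀ {A B C k l} → A ≈[ k ] B → B ≈[ l ] C → A ≈[ k + l ] C
≈-trans {k = k} {l} (A⊆ , B⊆A) (B⊆ , C⊆) =
  ⊆[]-trans A⊆ B⊆ , ⊆[]-weaken (≤-reflexive (+-comm l k)) (⊆[]-trans C⊆ B⊆A)

≈-++ : ∀ {A B C D k l} → A ≈[ k ] B → C ≈[ l ] D → A ++ C ≈[ k + l ] B ++ D
≈-++ (A⊆ , B⊆) (C⊆ , D⊆) = ⊆[]-++ A⊆ C⊆ , ⊆[]-++ B⊆ D⊆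

≈-short : ∀ {A B k} → length A ≤ k → length B ≤ k → A ≈[ k ] B
≈-short ∣A∣≤k ∣B∣≤k = ⊆[]-short ∣A∣≤k , ⊆[]-short ∣B∣≤k

⊆[]-resp-↭ : ∀ {A A′ B′ B k} → A ↭ A′ → B′ ↭ B → A′ ⊆[ k ] B′ → A ⊆[ k ] B
⊆[]-resp-↭ A↭ ↭B (X , ∣X∣≤k , A′⊆) =
  X , ∣X∣≤k , λ e∈ → ∈-resp-↭ (++⁺ˡ X ↭B) (A′⊆ (∈-resp-↭ A↭ e∈))

≈-via-↭ : ∀ {A A′ B′ B k} → A ↭ A′ → A′ ≈[ k ] B′ → B′ ↭ B → A ≈[ k ] B
≈-via-↭ A↭ (A′⊆ , B′⊆) ↭B = ⊆[]-resp-↭ A↭ ↭B A′⊆ , ⊆[]-resp-↭ (↭-sym ↭B) (↭-sym A↭) B′⊆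

≈-++-short : ∀ {A B k} → length B ≤ k → A ≈[ k ] A ++ B
≈-++-short {A} {B} ∣B∣≤k =
  ([] , z≤n , ∈-++⁺ˡ) , (B , ∣B∣≤k , λ e∈ → [ ∈-++⁺ʳ B , ∈-++⁺ˡ ]′ (∈-++⁻ A e∈))

≈-replace : ∀ {A C X₁ X₂ Y B₁ B₂ k c} → A ↭ X₁ ++ Y ++ B₁ → X₁ ≈[ k ] X₂ →
            length B₁ ≤ c → length B₂ ≤ c → X₂ ++ Y ++ B₂ ↭ C → A ≈[ k + c ] C
≈-replace {Y = Y} A↭ X₁≈X₂ ∣B₁∣≤c ∣B₂∣≤c ↭C =
  ≈-via-↭ A↭ (≈-++ X₁≈X₂ (≈-++ (≈-refl {Y}) (≈-short ∣B₁∣≤c ∣B₂∣≤c))) ↭C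

-- Matchings of consecutive blocks

InRange : ℕ → ℕ → Edge → Set
InRange lo hi (a , b) = lo < a × a < b × b ≤ hi

Ranked : ℕ → List Edge → Set
Ranked k M = Σ (Edge → ℕ) λ rank → All (λ e → rank e < k) M ×
             (∀ {e f} → e ∈ M → f ∈ M → Contains e f → rank f < rank e)

Exposed : ℕ → List Edge → Set
Exposed w M = ∀ {e} → e ∈ M → ¬ (proj₁ e < w × w < proj₂ e)

-- The unmatched vertex, if any, must be exposed, so that a bridge ending at it crosses no edge.
Coverage : ℕ → ℕ → List Edge → Maybe ℕ → Set
Coverage lo hi M nothing  = ∀ v → lo < v → v ≤ hi → Covered v M
Coverage lo hi M (just w) = (lo < w × w ≤ hi) × ¬ Covered w M ×
                            (∀ v → lo < v → v ≤ hi → v ≢ w → Covered v M) × Exposed w M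

record Valid (lo hi k : ℕ) (M : List Edge) (u : Maybe ℕ) : Set where
  field
    lo≤hi    : lo ≤ hi
    inRange  : All (InRange lo hi) M
    disjoint : AllPairs Disjoint M
    laminar  : Laminar M
    ranked   : Ranked k M
    coverage : Coverage lo hi M u

Ranked-weaken : ∀ {k l M} → k ≤ l → Ranked k M → Ranked l M
Ranked-weaken k≤l (rank , bounded , monotone) = rank , All.map (λ r<k → <-≤-trans r<k k≤l) bounded , monotone

Valid-weaken : ∀ {lo hi k l M u} → k ≤ l → Valid lo hi k M u → Valid lo hi l M u
Valid-weaken k≤l V = record
  { lo≤hi = lo≤hi ; inRange = inRange ; disjoint = disjoint ; laminar = laminar
  ; ranked = Ranked-weaken k≤l ranked ; coverage = coverage }
  where open Valid V

Ranked⇒DepthAtMost : ∀ {k M} → Ranked k M → DepthAtMost k M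
Ranked⇒DepthAtMost {k} {M} (rank , bounded , monotone) C C⊆M nested =
  chain-length k C C⊆M nested (All.tabulate (λ e∈C → All.lookup bounded (C⊆M e∈C)))
  where
  chain-length : ∀ j C → C ⊆ M → AllPairs Contains C → All (λ e → rank e < j) C → length C ≤ j
  chain-length j [] _ _ _ = z≤n
  chain-length j (e ∷ C) C⊆M (e⊃C ∷ nested) (re<j ∷ _) =
    <-≤-trans (s≤s (chain-length (rank e) C (λ f∈ → C⊆M (there f∈)) nested
                      (All.tabulate λ f∈ → monotone (C⊆M (here refl)) (C⊆M (there f∈)) (All.lookup e⊃C f∈))))
              re<j

Summary : Set
Summary = List Edge × Maybe ℕ

bridge : Maybe ℕ → Maybe ℕ → List Edge
bridge (just u) (just v) = (u , v) ∷ []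
bridge _        _        = []

leftover : Maybe ℕ → Maybe ℕ → Maybe ℕ
leftover nothing  v        = v
leftover (just u) nothing  = just u
leftover (just u) (just v) = nothing

combine : Summary → Summary → Summary
combine S T = proj₁ S ++ proj₁ T ++ bridge (proj₂ S) (proj₂ T) , leftover (proj₂ S) (proj₂ T)

length-bridge≤1 : ∀ u v → length (bridge u v) ≤ 1
length-bridge≤1 (just u) (just v) = s≤s z≤n
length-bridge≤1 (just u) nothing  = z≤n
length-bridge≤1 nothing  v        = z≤n

length-bridges≤2 : ∀ u v u′ v′ → length (bridge u v ++ bridge u′ v′) ≤ 2
length-bridges≤2 u v u′ v′ =
  ≤-trans (≤-reflexive (length-++ (bridge u v))) (+-mono-≤ (length-bridge≤1 u v) (length-bridge≤1 u′ v′))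

bridge-unique : ∀ u v {e f} → e ∈ bridge u v → f ∈ bridge u v → e ≡ f
bridge-unique (just u) (just v) (here refl) (here refl) = refl

bridge-disjoint : ∀ u v → AllPairs Disjoint (bridge u v)
bridge-disjoint (just u) (just v) = [] ∷ []
bridge-disjoint (just u) nothing  = []
bridge-disjoint nothing  v        = []

record BridgeEnds (lo mid hi : ℕ) (M₁ M₂ : List Edge) (e : Edge) : Set where
  field
    lo<u      : lo < proj₁ e
    u≤mid     : proj₁ e ≤ mid
    u-free    : ¬ Covered (proj₁ e) M₁
    u-exposed : Exposed (proj₁ e) M₁
    mid<v     : mid < proj₂ e
    v≤hi      : proj₂ e ≤ hi
    v-free    : ¬ Covered (proj₂ e) M₂
    v-exposed : Exposed (proj₂ e) M₂

bridge-ends : ∀ {lo mid hi M₁ M₂} u v → Coverage lo mid M₁ u → Coverage mid hi M₂ v →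
              ∀ {e} → e ∈ bridge u v → BridgeEnds lo mid hi M₁ M₂ e
bridge-ends (just u) (just v) ((lo<u , u≤mid) , u-free , _ , u-exposed)
                              ((mid<v , v≤hi) , v-free , _ , v-exposed) (here refl) =
  record { lo<u = lo<u ; u≤mid = u≤mid ; u-free = u-free ; u-exposed = u-exposed
         ; mid<v = mid<v ; v≤hi = v≤hi ; v-free = v-free ; v-exposed = v-exposed }

separated⇒Disjoint : ∀ {lo mid} e f → InRange lo mid e → mid < proj₁ f → proj₁ f < proj₂ f →
                     Disjoint e f
separated⇒Disjoint (a , b) (c , d) (_ , a<b , b≤mid) mid<c c<d =
  <⇒≢ (<-trans a<b b<c) , <⇒≢ (<-trans (<-trans a<b b<c) c<d) , <⇒≢ b<c , <⇒≢ (<-trans b<c c<d)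
  where b<c : b < c
        b<c = ≤-<-trans b≤mid mid<c

free-endpoints : ∀ {w M} e → e ∈ M → ¬ Covered w M → proj₁ e ≢ w × proj₂ e ≢ w
free-endpoints e e∈M w-free =
  (λ { refl → w-free (lose e∈M (inj₁ refl)) }) , (λ { refl → w-free (lose e∈M (inj₂ refl)) })

right-of⇒free : ∀ {lo mid w M} → All (InRange lo mid) M → mid < w → ¬ Covered w M
right-of⇒free inR mid<w w∈ with find w∈
... | e , e∈ , inj₁ refl = let (_ , a<b , b≤mid) = All.lookup inR e∈ in <⇒≱ mid<w (≤-trans (<⇒≤ a<b) b≤mid)
... | e , e∈ , inj₂ refl = let (_ , _ , b≤mid) = All.lookup inR e∈ in <⇒≱ mid<w b≤mid

left-of⇒free : ∀ {mid hi w M} → All (InRange mid hi) M → w ≤ mid → ¬ Covered w M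
left-of⇒free inR w≤mid w∈ with find w∈
... | e , e∈ , inj₁ refl = let (mid<a , _ , _) = All.lookup inR e∈ in <⇒≱ mid<a w≤mid
... | e , e∈ , inj₂ refl = let (mid<a , a<b , _) = All.lookup inR e∈ in <⇒≱ (<-trans mid<a a<b) w≤mid

module CombineValid {lo mid hi k M₁ M₂ u₁ u₂}
  (V₁ : Valid lo mid k M₁ u₁) (V₂ : Valid mid hi k M₂ u₂) where

  private
    module V₁ = Valid V₁
    module V₂ = Valid V₂

  B M : List Edge
  B = bridge u₁ u₂
  M = M₁ ++ M₂ ++ B

  data Part (e : Edge) : Set where
    left    : e ∈ M₁ → Part e
    right   : e ∈ M₂ → Part e
    bridged : e ∈ B  → Part e

  part : ∀ {e} → e ∈ M → Part e
  part e∈ with ∈-++⁻ M₁ e∈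
  ... | inj₁ e∈M₁ = left e∈M₁
  ... | inj₂ e∈M₂++B with ∈-++⁻ M₂ e∈M₂++B
  ...   | inj₁ e∈M₂ = right e∈M₂
  ...   | inj₂ e∈B  = bridged e∈B

  in₁ : ∀ {e} → e ∈ M₁ → InRange lo mid e
  in₁ = All.lookup V₁.inRange

  in₂ : ∀ {e} → e ∈ M₂ → InRange mid hi e
  in₂ = All.lookup V₂.inRange

  end≤mid : ∀ {e} → e ∈ M₁ → proj₂ e ≤ mid
  end≤mid p = proj₂ (proj₂ (in₁ p))

  start≤mid : ∀ {e} → e ∈ M₁ → proj₁ e ≤ mid
  start≤mid p = ≤-trans (<⇒≤ (proj₁ (proj₂ (in₁ p)))) (end≤mid p)

  mid<start : ∀ {e} → e ∈ M₂ → mid < proj₁ e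
  mid<start q = proj₁ (in₂ q)

  mid<end : ∀ {e} → e ∈ M₂ → mid < proj₂ e
  mid<end q = <-trans (mid<start q) (proj₁ (proj₂ (in₂ q)))

  ends : ∀ {e} → e ∈ B → BridgeEnds lo mid hi M₁ M₂ e
  ends = bridge-ends u₁ u₂ V₁.coverage V₂.coverage

  open BridgeEnds

  inRange : All (InRange lo hi) M
  inRange = All.tabulate λ e∈ → go (part e∈)
    where
    go : ∀ {e} → Part e → InRange lo hi e
    go (left p)    = let (lo<a , a<b , b≤mid) = in₁ p in lo<a , a<b , ≤-trans b≤mid V₂.lo≤hi
    go (right p)   = let (mid<a , a<b , b≤hi) = in₂ p in ≤-<-trans V₁.lo≤hi mid<a , a<b , b≤hi
    go (bridged p) = let E = ends p in lo<u E , ≤-<-trans (u≤mid E) (mid<v E) , v≤hi E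

  disjoint : AllPairs Disjoint M
  disjoint = AllPairsₚ.++⁺ V₁.disjoint (AllPairsₚ.++⁺ V₂.disjoint (bridge-disjoint u₁ u₂) M₂-B)
                          (All.tabulate λ e∈ → All.tabulate λ f∈ → M₁-rest e∈ (∈-++⁻ M₂ f∈))
    where
    M₂-B : All (λ e → All (Disjoint e) B) M₂
    M₂-B = All.tabulate λ {e} e∈ → All.tabulate λ {f} f∈ →
      let (mid<a , a<b , _) = in₂ e∈ ; E = ends f∈ ; (a≢v , b≢v) = free-endpoints e e∈ (v-free E) in
      (λ a≡u → <⇒≱ mid<a (subst (_≤ mid) (sym a≡u) (u≤mid E))) , a≢v ,
      (λ b≡u → <⇒≱ (<-trans mid<a a<b) (subst (_≤ mid) (sym b≡u) (u≤mid E))) , b≢v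
    M₁-rest : ∀ {e f} → e ∈ M₁ → f ∈ M₂ ⊎ f ∈ B → Disjoint e f
    M₁-rest {e} {f} e∈ (inj₁ f∈) = let (mid<c , c<d , _) = in₂ f∈ in separated⇒Disjoint e f (in₁ e∈) mid<c c<d
    M₁-rest {e} {f} e∈ (inj₂ f∈) =
      let (_ , a<b , b≤mid) = in₁ e∈ ; E = ends f∈ ; (a≢u , b≢u) = free-endpoints e e∈ (u-free E) in
      a≢u , (λ a≡v → <⇒≱ (mid<v E) (subst (_≤ mid) a≡v (≤-trans (<⇒≤ a<b) b≤mid))) ,
      b≢u , (λ b≡v → <⇒≱ (mid<v E) (subst (_≤ mid) b≡v b≤mid))

  laminar : Laminar M
  laminar {e} {f} e∈ f∈ crossing@(a₁<a₂ , a₂<b₁ , b₁<b₂) = go (part e∈) (part f∈)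
    where
    go : Part e → Part f → _
    go (left p)    (left q)    = V₁.laminar p q crossing
    go (left p)    (right q)   = <⇒≱ (<-trans (mid<start q) a₂<b₁) (end≤mid p)
    go (left p)    (bridged q) = u-exposed (ends q) p (a₁<a₂ , a₂<b₁)
    go (right p)   (left q)    = <⇒≱ (<-trans (mid<start p) a₁<a₂) (start≤mid q)
    go (right p)   (right q)   = V₂.laminar p q crossing
    go (right p)   (bridged q) = <⇒≱ (<-trans (mid<start p) a₁<a₂) (u≤mid (ends q))
    go (bridged p) (left q)    = <⇒≱ (<-trans (mid<v (ends p)) b₁<b₂) (end≤mid q)
    go (bridged p) (right q)   = v-exposed (ends p) q (a₂<b₁ , b₁<b₂)
    go (bridged p) (bridged q) with bridge-unique u₁ u₂ p q
    ... | refl = <-irrefl refl a₁<a₂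

  private
    ρ₁ ρ₂ : Edge → ℕ
    ρ₁ = proj₁ V₁.ranked
    ρ₂ = proj₁ V₂.ranked

  -- Edges wholly left or right of mid keep their ranks; the bridge, the only edge straddling mid, gets the top rank k.
  rank : Edge → ℕ
  rank e with proj₂ e ≤? mid | proj₁ e ≤? mid
  ... | yes _ | _     = ρ₁ e
  ... | no _  | yes _ = k
  ... | no _  | no _  = ρ₂ e

  rank-left : ∀ {e} → e ∈ M₁ → rank e ≡ ρ₁ e
  rank-left {e} p with proj₂ e ≤? mid
  ... | yes _    = refl
  ... | no b≰mid = ⊥-elim (b≰mid (end≤mid p))

  rank-right : ∀ {e} → e ∈ M₂ → rank e ≡ ρ₂ e
  rank-right {e} p with proj₂ e ≤? mid | proj₁ e ≤? mid
  ... | yes b≤mid | _         = ⊥-elim (<⇒≱ (mid<end p) b≤mid)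
  ... | no _      | yes a≤mid = ⊥-elim (<⇒≱ (mid<start p) a≤mid)
  ... | no _      | no _      = refl

  rank-bridged : ∀ {e} → e ∈ B → rank e ≡ k
  rank-bridged {e} p with proj₂ e ≤? mid | proj₁ e ≤? mid
  ... | yes b≤mid | _        = ⊥-elim (<⇒≱ (mid<v (ends p)) b≤mid)
  ... | no _      | yes _    = refl
  ... | no _      | no a≰mid = ⊥-elim (a≰mid (u≤mid (ends p)))

  ranked : Ranked (suc k) M
  ranked = rank , All.tabulate (λ e∈ → bounded (part e∈)) , λ e∈ f∈ → monotone (part e∈) (part f∈)
    where
    bounded : ∀ {e} → Part e → rank e < suc k
    bounded (left p)    rewrite rank-left p    = m<n⇒m<1+n (All.lookup (proj₁ (proj₂ V₁.ranked)) p)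
    bounded (right p)   rewrite rank-right p   = m<n⇒m<1+n (All.lookup (proj₁ (proj₂ V₂.ranked)) p)
    bounded (bridged p) rewrite rank-bridged p = ≤-refl
    monotone : ∀ {e f} → Part e → Part f → Contains e f → rank f < rank e
    monotone (left p)    (left q)  e⊃f rewrite rank-left p    | rank-left q  = proj₂ (proj₂ V₁.ranked) p q e⊃f
    monotone (right p)   (right q) e⊃f rewrite rank-right p   | rank-right q = proj₂ (proj₂ V₂.ranked) p q e⊃f
    monotone (bridged p) (left q)  _   rewrite rank-bridged p | rank-left q  = All.lookup (proj₁ (proj₂ V₁.ranked)) q
    monotone (bridged p) (right q) _   rewrite rank-bridged p | rank-right q = All.lookup (proj₁ (proj₂ V₂.ranked)) q
    monotone (left p)  (right q)   (_ , b₂<b₁) = ⊥-elim (<⇒≱ (mid<end q) (≤-trans (<⇒≤ b₂<b₁) (end≤mid p)))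
    monotone (left p)  (bridged q) (_ , b₂<b₁) = ⊥-elim (<⇒≱ (mid<v (ends q)) (≤-trans (<⇒≤ b₂<b₁) (end≤mid p)))
    monotone (right p) (left q)    (a₁<a₂ , _) = ⊥-elim (<⇒≱ (<-trans (mid<start p) a₁<a₂) (start≤mid q))
    monotone (right p) (bridged q) (a₁<a₂ , _) = ⊥-elim (<⇒≱ (<-trans (mid<start p) a₁<a₂) (u≤mid (ends q)))
    monotone (bridged p) (bridged q) (a₁<a₂ , _) with bridge-unique u₁ u₂ p q
    ... | refl = ⊥-elim (<-irrefl refl a₁<a₂)

covered-left : ∀ {v} M₁ {R} → Covered v M₁ → Covered v (M₁ ++ R)
covered-left M₁ = Any.++⁺ˡ

covered-middle : ∀ {v} M₁ M₂ {R} → Covered v M₂ → Covered v (M₁ ++ M₂ ++ R)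
covered-middle M₁ M₂ c = Any.++⁺ʳ M₁ (Any.++⁺ˡ c)

free-in-++ : ∀ {v} M₁ M₂ → ¬ Covered v M₁ → ¬ Covered v M₂ → ¬ Covered v (M₁ ++ M₂ ++ [])
free-in-++ M₁ M₂ free₁ free₂ c with Any.++⁻ M₁ c
... | inj₁ c₁ = free₁ c₁
... | inj₂ c₂ with Any.++⁻ M₂ c₂
...   | inj₁ c₂′ = free₂ c₂′
...   | inj₂ ()

combine-coverage : ∀ {lo mid hi M₁ M₂} u₁ u₂ → lo ≤ mid → mid ≤ hi →
                   All (InRange lo mid) M₁ → All (InRange mid hi) M₂ →
                   Coverage lo mid M₁ u₁ → Coverage mid hi M₂ u₂ →
                   Coverage lo hi (M₁ ++ M₂ ++ bridge u₁ u₂) (leftover u₁ u₂)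
combine-coverage {mid = mid} {M₁ = M₁} {M₂} nothing nothing _ _ _ _ cov₁ cov₂ v lo<v v≤hi with v ≤? mid
... | yes v≤mid = covered-left M₁ (cov₁ v lo<v v≤mid)
... | no v≰mid  = covered-middle M₁ M₂ (cov₂ v (≰⇒> v≰mid) v≤hi)
combine-coverage {mid = mid} {M₁ = M₁} {M₂} nothing (just w) lo≤mid _ inR₁ _ cov₁
                 ((mid<w , w≤hi) , w-free , others , w-exposed) =
  (≤-<-trans lo≤mid mid<w , w≤hi) , free-in-++ M₁ M₂ (right-of⇒free inR₁ mid<w) w-free , others′ , exposed
  where
  others′ : ∀ v → _ < v → v ≤ _ → v ≢ w → Covered v (M₁ ++ M₂ ++ [])
  others′ v lo<v v≤hi v≢w with v ≤? mid
  ... | yes v≤mid = covered-left M₁ (cov₁ v lo<v v≤mid)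
  ... | no v≰mid  = covered-middle M₁ M₂ (others v (≰⇒> v≰mid) v≤hi v≢w)
  exposed : Exposed w (M₁ ++ M₂ ++ [])
  exposed e∈ (a<w , w<b) with ∈-++⁻ M₁ e∈
  ... | inj₁ e∈M₁ = <⇒≱ mid<w (≤-trans (<⇒≤ w<b) (proj₂ (proj₂ (All.lookup inR₁ e∈M₁))))
  ... | inj₂ e∈M₂++[] with ∈-++⁻ M₂ e∈M₂++[]
  ...   | inj₁ e∈M₂ = w-exposed e∈M₂ (a<w , w<b)
  ...   | inj₂ ()
combine-coverage {mid = mid} {M₁ = M₁} {M₂} (just w) nothing _ mid≤hi _ inR₂
                 ((lo<w , w≤mid) , w-free , others , w-exposed) cov₂ =
  (lo<w , ≤-trans w≤mid mid≤hi) , free-in-++ M₁ M₂ w-free (left-of⇒free inR₂ w≤mid) , others′ , exposed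
  where
  others′ : ∀ v → _ < v → v ≤ _ → v ≢ w → Covered v (M₁ ++ M₂ ++ [])
  others′ v lo<v v≤hi v≢w with v ≤? mid
  ... | yes v≤mid = covered-left M₁ (others v lo<v v≤mid v≢w)
  ... | no v≰mid  = covered-middle M₁ M₂ (cov₂ v (≰⇒> v≰mid) v≤hi)
  exposed : Exposed w (M₁ ++ M₂ ++ [])
  exposed e∈ (a<w , w<b) with ∈-++⁻ M₁ e∈
  ... | inj₁ e∈M₁ = w-exposed e∈M₁ (a<w , w<b)
  ... | inj₂ e∈M₂++[] with ∈-++⁻ M₂ e∈M₂++[]
  ...   | inj₁ e∈M₂ = <⇒≱ (<-trans (proj₁ (All.lookup inR₂ e∈M₂)) a<w) w≤mid
  ...   | inj₂ ()
combine-coverage {mid = mid} {M₁ = M₁} {M₂} (just u) (just w) _ _ _ _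
                 ((_ , u≤mid) , _ , others₁ , _) ((mid<w , _) , _ , others₂ , _) v lo<v v≤hi
  with v ≤? mid
... | yes v≤mid with v ≟ u
...   | yes refl = Any.++⁺ʳ M₁ (Any.++⁺ʳ M₂ (here (inj₁ refl)))
...   | no v≢u   = covered-left M₁ (others₁ v lo<v v≤mid v≢u)
combine-coverage {mid = mid} {M₁ = M₁} {M₂} (just u) (just w) _ _ _ _
                 _ ((mid<w , _) , _ , others₂ , _) v lo<v v≤hi
  | no v≰mid with v ≟ w
...   | yes refl = Any.++⁺ʳ M₁ (Any.++⁺ʳ M₂ (here (inj₂ refl)))
...   | no v≢w   = covered-middle M₁ M₂ (others₂ v (≰⇒> v≰mid) v≤hi v≢w)

combine-valid : ∀ {lo mid hi k M₁ M₂ u₁ u₂} → Valid lo mid k M₁ u₁ → Valid mid hi k M₂ u₂ →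
                Valid lo hi (suc k) (M₁ ++ M₂ ++ bridge u₁ u₂) (leftover u₁ u₂)
combine-valid {u₁ = u₁} {u₂} V₁ V₂ = record
  { lo≤hi = ≤-trans (Valid.lo≤hi V₁) (Valid.lo≤hi V₂)
  ; inRange = inRange ; disjoint = disjoint ; laminar = laminar ; ranked = ranked
  ; coverage = combine-coverage u₁ u₂ (Valid.lo≤hi V₁) (Valid.lo≤hi V₂) (Valid.inRange V₁) (Valid.inRange V₂)
                                (Valid.coverage V₁) (Valid.coverage V₂) }
  where open CombineValid V₁ V₂

-- 2-3 trees

data Tree : ℕ → Set where
  leaf  : Tree 0
  node2 : ∀ {h} → Tree h → Tree h → Tree (suc h)
  node3 : ∀ {h} → Tree h → Tree h → Tree h → Tree (suc h)

size : ∀ {h} → Tree h → ℕ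
size leaf          = 1
size (node2 a b)   = size a + size b
size (node3 a b c) = size a + size b + size c

-- The leaves of a tree placed at offset o are o + 1, …, o + size t.
summary : ∀ {h} → ℕ → Tree h → Summary
summary o leaf          = [] , just (suc o)
summary o (node2 a b)   = combine (summary o a) (summary (o + size a) b)
summary o (node3 a b c) = combine (combine (summary o a) (summary (o + size a) b)) (summary (o + size a + size b) c)

matching : ∀ {h} → ℕ → Tree h → List Edge
matching o t = proj₁ (summary o t)

unmatched : ∀ {h} → ℕ → Tree h → Maybe ℕ
unmatched o t = proj₂ (summary o t)

leaf-valid : ∀ o → Valid o (o + 1) 0 [] (just (suc o))
leaf-valid o = record
  { lo≤hi = m≤m+n o 1 ; inRange = [] ; disjoint = [] ; laminar = λ () ; ranked = (λ _ → 0) , [] , λ ()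
  ; coverage = (n<1+n o , ≤-reflexive (+-comm 1 o)) , (λ ()) , only-leaf , λ () }
  where
  only-leaf : ∀ v → o < v → v ≤ o + 1 → v ≢ suc o → Covered v []
  only-leaf v o<v v≤o+1 v≢1+o = ⊥-elim (v≢1+o (≤-antisym (≤-trans v≤o+1 (≤-reflexive (+-comm o 1))) o<v))

tree-valid : ∀ {h} o (t : Tree h) → Valid o (o + size t) (h + h) (matching o t) (unmatched o t)
tree-valid o leaf = leaf-valid o
tree-valid {suc h} o (node2 a b) =
  subst (λ hi → Valid o hi (suc h + suc h) (matching o (node2 a b)) (unmatched o (node2 a b)))
        (+-assoc o (size a) (size b))
        (Valid-weaken (≤-trans (n≤1+n _) 2h+2≤) (combine-valid (tree-valid o a) (tree-valid (o + size a) b)))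
  where 2h+2≤ : suc (suc (h + h)) ≤ suc h + suc h
        2h+2≤ = s≤s (≤-reflexive (sym (+-suc h h)))
tree-valid {suc h} o (node3 a b c) =
  subst (λ hi → Valid o hi (suc h + suc h) (matching o (node3 a b c)) (unmatched o (node3 a b c)))
        (offset-assoc o (size a) (size b) (size c))
        (Valid-weaken 2h+2≤ (combine-valid (combine-valid (tree-valid o a) (tree-valid (o + size a) b))
                                            (Valid-weaken (n≤1+n _) (tree-valid (o + size a + size b) c))))
  where 2h+2≤ : suc (suc (h + h)) ≤ suc h + suc h
        2h+2≤ = s≤s (≤-reflexive (sym (+-suc h h)))
        offset-assoc : ∀ o a b c → o + a + b + c ≡ o + (a + b + c)
        offset-assoc = solve-∀

shiftSummary : ℕ → Summary → Summary
shiftSummary m S = shift m (proj₁ S) , Maybe.map (_+ m) (proj₂ S)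

bridge-shift : ∀ m u v → bridge (Maybe.map (_+ m) u) (Maybe.map (_+ m) v) ≡ shift m (bridge u v)
bridge-shift m (just u) (just v) = refl
bridge-shift m (just u) nothing  = refl
bridge-shift m nothing  v        = refl

leftover-shift : ∀ m u v → leftover (Maybe.map (_+ m) u) (Maybe.map (_+ m) v) ≡ Maybe.map (_+ m) (leftover u v)
leftover-shift m (just u) (just v) = refl
leftover-shift m (just u) nothing  = refl
leftover-shift m nothing  v        = refl

combine-shift : ∀ m S T → combine (shiftSummary m S) (shiftSummary m T) ≡ shiftSummary m (combine S T)
combine-shift m (M₁ , u₁) (M₂ , u₂) = cong₂ _,_ edges (leftover-shift m u₁ u₂)
  where
  edges : shift m M₁ ++ shift m M₂ ++ bridge (Maybe.map (_+ m) u₁) (Maybe.map (_+ m) u₂)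
        ≡ shift m (M₁ ++ M₂ ++ bridge u₁ u₂)
  edges = begin
    shift m M₁ ++ shift m M₂ ++ bridge (Maybe.map (_+ m) u₁) (Maybe.map (_+ m) u₂)
      ≡⟨ cong (λ B → shift m M₁ ++ shift m M₂ ++ B) (bridge-shift m u₁ u₂) ⟩
    shift m M₁ ++ shift m M₂ ++ shift m (bridge u₁ u₂)
      ≡⟨ cong (shift m M₁ ++_) (sym (map-++ _ M₂ (bridge u₁ u₂))) ⟩
    shift m M₁ ++ shift m (M₂ ++ bridge u₁ u₂)
      ≡⟨ sym (map-++ _ M₁ _) ⟩
    shift m (M₁ ++ M₂ ++ bridge u₁ u₂) ∎
    where open ≡-Reasoning

swap-offset : ∀ o m a → o + m + a ≡ o + a + m
swap-offset = solve-∀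

summary-shift : ∀ {h} o m (t : Tree h) → summary (o + m) t ≡ shiftSummary m (summary o t)
summary-shift o m leaf = refl
summary-shift o m (node2 a b)
  rewrite swap-offset o m (size a) | summary-shift o m a | summary-shift (o + size a) m b =
  combine-shift m (summary o a) (summary (o + size a) b)
summary-shift o m (node3 a b c)
  rewrite swap-offset o m (size a) | swap-offset (o + size a) m (size b)
        | summary-shift o m a | summary-shift (o + size a) m b | summary-shift (o + size a + size b) m c =
  trans (cong (λ S → combine S (shiftSummary m (summary (o + size a + size b) c)))
              (combine-shift m (summary o a) (summary (o + size a) b)))
        (combine-shift m (combine (summary o a) (summary (o + size a) b)) (summary (o + size a + size b) c))

matching-shift : ∀ {h} m (t : Tree h) → matching m t ≡ shift m (matching 0 t)
matching-shift m t = cong proj₁ (summary-shift 0 m t)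

-- Joining

matching₂ : ∀ {h₁ h₂} → ℕ → Tree h₁ → Tree h₂ → List Edge
matching₂ o s t = matching o s ++ matching (o + size s) t

data Grown (h : ℕ) : Set where
  one : Tree h → Grown h
  two : Tree h → Tree h → Grown h

sizeᴳ : ∀ {h} → Grown h → ℕ
sizeᴳ (one t)   = size t
sizeᴳ (two s t) = size s + size t

matchingᴳ : ∀ {h} → ℕ → Grown h → List Edge
matchingᴳ o (one t)   = matching o t
matchingᴳ o (two s t) = matching₂ o s t

record Joined {h₁ h₂} (h : ℕ) (k : ℕ) (s : Tree h₁) (t : Tree h₂) : Set where
  field
    grown       : Grown h
    size-grown  : sizeᴳ grown ≡ size s + size t
    edges-grown : ∀ o → matching₂ o s t ≈[ k ] matchingᴳ o grown

join-cost-step : ∀ d {c} → c ≤ 2 → 2 * d + c ≤ 2 * suc d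
join-cost-step d c≤2 =
  ≤-trans (+-monoʳ-≤ (2 * d) c≤2) (≤-reflexive (trans (+-comm (2 * d) 2) (sym (*-suc 2 d))))

joinRight-node2 : ∀ {d h} {t : Tree h} (a b : Tree (d + h)) →
                  Joined (d + h) (2 * d) b t → Joined (suc d + h) (2 * suc d) (node2 a b) t
joinRight-node2 {d} {t = t} a b record { grown = one b′ ; size-grown = size-b′ ; edges-grown = E } = record
  { grown = one (node2 a b′)
  ; size-grown = trans (cong (size a +_) size-b′) (sym (+-assoc (size a) (size b) (size t)))
  ; edges-grown = edges }
  where
  edges : ∀ o → matching₂ o (node2 a b) t ≈[ 2 * suc d ] matching o (node2 a b′)
  edges o rewrite sym (+-assoc o (size a) (size b)) =
    ≈-weaken (join-cost-step d (s≤s z≤n))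
      (≈-replace {Y = Mᵃ} (solve 4 (λ A B β T → (A ⊕ B ⊕ β) ⊕ T ⊜ (B ⊕ T) ⊕ A ⊕ β) ↭-refl Mᵃ Mᵇ β Mᵗ)
                 (E (o + size a)) (length-bridge≤1 uᵃ uᵇ) (length-bridge≤1 uᵃ uᵇ′)
                 (solve 3 (λ B′ A β′ → B′ ⊕ A ⊕ β′ ⊜ A ⊕ B′ ⊕ β′) ↭-refl Mᵇ′ Mᵃ (bridge uᵃ uᵇ′)))
    where
    Mᵃ Mᵇ Mᵇ′ Mᵗ β : List Edge
    uᵃ uᵇ uᵇ′ : Maybe ℕ
    Mᵃ = matching o a
    Mᵇ = matching (o + size a) b
    Mᵇ′ = matching (o + size a) b′
    Mᵗ = matching (o + size a + size b) t
    uᵃ = unmatched o a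
    uᵇ = unmatched (o + size a) b
    uᵇ′ = unmatched (o + size a) b′
    β = bridge uᵃ uᵇ
joinRight-node2 {d} {t = t} a b record { grown = two b₁ b₂ ; size-grown = size-b₁b₂ ; edges-grown = E } = record
  { grown = one (node3 a b₁ b₂)
  ; size-grown = trans (+-assoc (size a) (size b₁) (size b₂))
                       (trans (cong (size a +_) size-b₁b₂) (sym (+-assoc (size a) (size b) (size t))))
  ; edges-grown = edges }
  where
  edges : ∀ o → matching₂ o (node2 a b) t ≈[ 2 * suc d ] matching o (node3 a b₁ b₂)
  edges o rewrite sym (+-assoc o (size a) (size b)) =
    ≈-weaken (join-cost-step d ≤-refl)
      (≈-replace {Y = Mᵃ} (solve 4 (λ A B β T → (A ⊕ B ⊕ β) ⊕ T ⊜ (B ⊕ T) ⊕ A ⊕ β) ↭-refl Mᵃ Mᵇ β Mᵗ)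
                 (E (o + size a)) (m≤n⇒m≤1+n (length-bridge≤1 uᵃ uᵇ)) (length-bridges≤2 uᵃ uᵇ₁ (leftover uᵃ uᵇ₁) uᵇ₂)
                 (solve 5 (λ B₁ B₂ A β₁ β₂ → (B₁ ⊕ B₂) ⊕ A ⊕ β₁ ⊕ β₂ ⊜ (A ⊕ B₁ ⊕ β₁) ⊕ B₂ ⊕ β₂) ↭-refl
                          Mᵇ₁ Mᵇ₂ Mᵃ (bridge uᵃ uᵇ₁) (bridge (leftover uᵃ uᵇ₁) uᵇ₂)))
    where
    Mᵃ Mᵇ Mᵇ₁ Mᵇ₂ Mᵗ β : List Edge
    uᵃ uᵇ uᵇ₁ uᵇ₂ : Maybe ℕ
    Mᵃ = matching o a
    Mᵇ = matching (o + size a) b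
    Mᵇ₁ = matching (o + size a) b₁
    Mᵇ₂ = matching (o + size a + size b₁) b₂
    Mᵗ = matching (o + size a + size b) t
    uᵃ = unmatched o a
    uᵇ = unmatched (o + size a) b
    uᵇ₁ = unmatched (o + size a) b₁
    uᵇ₂ = unmatched (o + size a + size b₁) b₂
    β = bridge uᵃ uᵇ
joinRight-node3 : ∀ {d h} {t : Tree h} (a b c : Tree (d + h)) →
                  Joined (d + h) (2 * d) c t → Joined (suc d + h) (2 * suc d) (node3 a b c) t
joinRight-node3 {d} {t = t} a b c record { grown = one c′ ; size-grown = size-c′ ; edges-grown = E } = record
  { grown = one (node3 a b c′)
  ; size-grown = trans (cong (size a + size b +_) size-c′) (sym (+-assoc (size a + size b) (size c) (size t)))
  ; edges-grown = edges }
  where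
  edges : ∀ o → matching₂ o (node3 a b c) t ≈[ 2 * suc d ] matching o (node3 a b c′)
  edges o rewrite sym (+-assoc o (size a + size b) (size c)) | sym (+-assoc o (size a) (size b)) =
    ≈-weaken (join-cost-step d (s≤s z≤n))
      (≈-replace {Y = Mᵃᵇ} (solve 4 (λ P C β T → (P ⊕ C ⊕ β) ⊕ T ⊜ (C ⊕ T) ⊕ P ⊕ β) ↭-refl Mᵃᵇ Mᶜ β Mᵗ)
                 (E (o + size a + size b)) (length-bridge≤1 uᵃᵇ uᶜ) (length-bridge≤1 uᵃᵇ uᶜ′)
                 (solve 3 (λ C′ P β′ → C′ ⊕ P ⊕ β′ ⊜ P ⊕ C′ ⊕ β′) ↭-refl Mᶜ′ Mᵃᵇ (bridge uᵃᵇ uᶜ′)))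
    where
    Mᵃᵇ Mᶜ Mᶜ′ Mᵗ β : List Edge
    uᵃᵇ uᶜ uᶜ′ : Maybe ℕ
    Mᵃᵇ = matching o (node2 a b)
    Mᶜ = matching (o + size a + size b) c
    Mᶜ′ = matching (o + size a + size b) c′
    Mᵗ = matching (o + size a + size b + size c) t
    uᵃᵇ = unmatched o (node2 a b)
    uᶜ = unmatched (o + size a + size b) c
    uᶜ′ = unmatched (o + size a + size b) c′
    β = bridge uᵃᵇ uᶜ
joinRight-node3 {d} {t = t} a b c record { grown = two c₁ c₂ ; size-grown = size-c₁c₂ ; edges-grown = E } = record
  { grown = two (node2 a b) (node2 c₁ c₂)
  ; size-grown = trans (cong (size a + size b +_) size-c₁c₂) (sym (+-assoc (size a + size b) (size c) (size t)))
  ; edges-grown = edges }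
  where
  edges : ∀ o → matching₂ o (node3 a b c) t ≈[ 2 * suc d ] matching₂ o (node2 a b) (node2 c₁ c₂)
  edges o rewrite sym (+-assoc o (size a + size b) (size c)) | sym (+-assoc o (size a) (size b)) =
    ≈-weaken (join-cost-step d (s≤s z≤n))
      (≈-replace {Y = Mᵃᵇ} (solve 4 (λ P C β T → (P ⊕ C ⊕ β) ⊕ T ⊜ (C ⊕ T) ⊕ P ⊕ β) ↭-refl Mᵃᵇ Mᶜ β Mᵗ)
                 (E (o + size a + size b)) (length-bridge≤1 uᵃᵇ uᶜ) (length-bridge≤1 uᶜ₁ uᶜ₂)
                 (solve 4 (λ C₁ C₂ P β′ → (C₁ ⊕ C₂) ⊕ P ⊕ β′ ⊜ P ⊕ C₁ ⊕ C₂ ⊕ β′) ↭-refl Mᶜ₁ Mᶜ₂ Mᵃᵇ (bridge uᶜ₁ uᶜ₂)))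
    where
    Mᵃᵇ Mᶜ Mᶜ₁ Mᶜ₂ Mᵗ β : List Edge
    uᵃᵇ uᶜ uᶜ₁ uᶜ₂ : Maybe ℕ
    Mᵃᵇ = matching o (node2 a b)
    Mᶜ = matching (o + size a + size b) c
    Mᶜ₁ = matching (o + size a + size b) c₁
    Mᶜ₂ = matching (o + size a + size b + size c₁) c₂
    Mᵗ = matching (o + size a + size b + size c) t
    uᵃᵇ = unmatched o (node2 a b)
    uᶜ = unmatched (o + size a + size b) c
    uᶜ₁ = unmatched (o + size a + size b) c₁
    uᶜ₂ = unmatched (o + size a + size b + size c₁) c₂
    β = bridge uᵃᵇ uᶜ

joinRight : ∀ d {h} (s : Tree (d + h)) (t : Tree h) → Joined (d + h) (2 * d) s t
joinRight zero s t = record { grown = two s t ; size-grown = refl ; edges-grown = λ _ → ≈-refl }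
joinRight (suc d) (node2 a b)   t = joinRight-node2 a b (joinRight d b t)
joinRight (suc d) (node3 a b c) t = joinRight-node3 a b c (joinRight d c t)

joinLeft-node2 : ∀ {d h} {s : Tree h} (a b : Tree (d + h)) →
                 Joined (d + h) (2 * d) s a → Joined (suc d + h) (2 * suc d) s (node2 a b)
joinLeft-node2 {d} {s = s} a b record { grown = one a′ ; size-grown = size-a′ ; edges-grown = E } = record
  { grown = one (node2 a′ b)
  ; size-grown = trans (cong (_+ size b) size-a′) (+-assoc (size s) (size a) (size b))
  ; edges-grown = edges }
  where
  edges : ∀ o → matching₂ o s (node2 a b) ≈[ 2 * suc d ] matching o (node2 a′ b)
  edges o rewrite size-a′ | +-assoc o (size s) (size a) =
    ≈-weaken (join-cost-step d (s≤s z≤n))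
      (≈-replace {Y = Mᵇ} (solve 4 (λ S A B β → S ⊕ A ⊕ B ⊕ β ⊜ (S ⊕ A) ⊕ B ⊕ β) ↭-refl Mˢ Mᵃ Mᵇ β)
                 (E o) (length-bridge≤1 uᵃ uᵇ) (length-bridge≤1 (unmatched o a′) uᵇ) ↭-refl)
    where
    Mˢ Mᵃ Mᵇ β : List Edge
    uᵃ uᵇ : Maybe ℕ
    Mˢ = matching o s
    Mᵃ = matching (o + size s) a
    Mᵇ = matching (o + (size s + size a)) b
    uᵃ = unmatched (o + size s) a
    uᵇ = unmatched (o + (size s + size a)) b
    β = bridge uᵃ uᵇ
joinLeft-node2 {d} {s = s} a b record { grown = two a₁ a₂ ; size-grown = size-a₁a₂ ; edges-grown = E } = record
  { grown = one (node3 a₁ a₂ b)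
  ; size-grown = trans (cong (_+ size b) size-a₁a₂) (+-assoc (size s) (size a) (size b))
  ; edges-grown = edges }
  where
  edges : ∀ o → matching₂ o s (node2 a b) ≈[ 2 * suc d ] matching o (node3 a₁ a₂ b)
  edges o rewrite +-assoc o (size a₁) (size a₂) | size-a₁a₂ | +-assoc o (size s) (size a) =
    ≈-weaken (join-cost-step d ≤-refl)
      (≈-replace {Y = Mᵇ} (solve 4 (λ S A B β → S ⊕ A ⊕ B ⊕ β ⊜ (S ⊕ A) ⊕ B ⊕ β) ↭-refl Mˢ Mᵃ Mᵇ β)
                 (E o) (m≤n⇒m≤1+n (length-bridge≤1 uᵃ uᵇ)) (length-bridges≤2 uᵃ¹ uᵃ² (leftover uᵃ¹ uᵃ²) uᵇ)
                 (solve 5 (λ A₁ A₂ B β₁ β₂ → (A₁ ⊕ A₂) ⊕ B ⊕ β₁ ⊕ β₂ ⊜ (A₁ ⊕ A₂ ⊕ β₁) ⊕ B ⊕ β₂) ↭-refl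
                          (matching o a₁) (matching (o + size a₁) a₂) Mᵇ (bridge uᵃ¹ uᵃ²) (bridge (leftover uᵃ¹ uᵃ²) uᵇ)))
    where
    Mˢ Mᵃ Mᵇ β : List Edge
    uᵃ uᵇ uᵃ¹ uᵃ² : Maybe ℕ
    Mˢ = matching o s
    Mᵃ = matching (o + size s) a
    Mᵇ = matching (o + (size s + size a)) b
    uᵃ = unmatched (o + size s) a
    uᵇ = unmatched (o + (size s + size a)) b
    uᵃ¹ = unmatched o a₁
    uᵃ² = unmatched (o + size a₁) a₂
    β = bridge uᵃ uᵇ
joinLeft-node3 : ∀ {d h} {s : Tree h} (a b c : Tree (d + h)) →
                 Joined (d + h) (2 * d) s a → Joined (suc d + h) (2 * suc d) s (node3 a b c)
joinLeft-node3 {d} {s = s} a b c record { grown = one a′ ; size-grown = size-a′ ; edges-grown = E } = record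
  { grown = one (node3 a′ b c)
  ; size-grown = trans (cong (λ n → n + size b + size c) size-a′) (regroup (size s) (size a) (size b) (size c))
  ; edges-grown = edges }
  where
  edges : ∀ o → matching₂ o s (node3 a b c) ≈[ 2 * suc d ] matching o (node3 a′ b c)
  edges o rewrite size-a′ | +-assoc o (size s) (size a) =
    ≈-weaken (join-cost-step d ≤-refl)
      (≈-replace {Y = Mᵇ ++ Mᶜ}
                 (solve 6 (λ S A B C β₁ β₂ → S ⊕ (A ⊕ B ⊕ β₁) ⊕ C ⊕ β₂ ⊜ (S ⊕ A) ⊕ (B ⊕ C) ⊕ β₁ ⊕ β₂) ↭-refl
                          Mˢ Mᵃ Mᵇ Mᶜ (bridge uᵃ uᵇ) (bridge (leftover uᵃ uᵇ) uᶜ))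
                 (E o) (length-bridges≤2 uᵃ uᵇ (leftover uᵃ uᵇ) uᶜ) (length-bridges≤2 uᵃ′ uᵇ (leftover uᵃ′ uᵇ) uᶜ)
                 (solve 5 (λ A′ B C β₁ β₂ → A′ ⊕ (B ⊕ C) ⊕ β₁ ⊕ β₂ ⊜ (A′ ⊕ B ⊕ β₁) ⊕ C ⊕ β₂) ↭-refl
                          (matching o a′) Mᵇ Mᶜ (bridge uᵃ′ uᵇ) (bridge (leftover uᵃ′ uᵇ) uᶜ)))
    where
    Mˢ Mᵃ Mᵇ Mᶜ : List Edge
    uᵃ uᵃ′ uᵇ uᶜ : Maybe ℕ
    Mˢ = matching o s
    Mᵃ = matching (o + size s) a
    Mᵇ = matching (o + (size s + size a)) b
    Mᶜ = matching (o + (size s + size a) + size b) c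
    uᵃ = unmatched (o + size s) a
    uᵃ′ = unmatched o a′
    uᵇ = unmatched (o + (size s + size a)) b
    uᶜ = unmatched (o + (size s + size a) + size b) c
  regroup : ∀ s a b c → s + a + b + c ≡ s + (a + b + c)
  regroup = solve-∀
joinLeft-node3 {d} {s = s} a b c record { grown = two a₁ a₂ ; size-grown = size-a₁a₂ ; edges-grown = E } = record
  { grown = two (node2 a₁ a₂) (node2 b c)
  ; size-grown = trans (cong (_+ (size b + size c)) size-a₁a₂) (regroup (size s) (size a) (size b) (size c))
  ; edges-grown = edges }
  where
  edges : ∀ o → matching₂ o s (node3 a b c) ≈[ 2 * suc d ] matching₂ o (node2 a₁ a₂) (node2 b c)
  edges o rewrite size-a₁a₂ | +-assoc o (size s) (size a) =
    ≈-weaken (join-cost-step d ≤-refl)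
      (≈-replace {Y = Mᵇ ++ Mᶜ}
                 (solve 6 (λ S A B C β₁ β₂ → S ⊕ (A ⊕ B ⊕ β₁) ⊕ C ⊕ β₂ ⊜ (S ⊕ A) ⊕ (B ⊕ C) ⊕ β₁ ⊕ β₂) ↭-refl
                          Mˢ Mᵃ Mᵇ Mᶜ (bridge uᵃ uᵇ) (bridge (leftover uᵃ uᵇ) uᶜ))
                 (E o) (length-bridges≤2 uᵃ uᵇ (leftover uᵃ uᵇ) uᶜ) (length-bridges≤2 uᵃ¹ uᵃ² uᵇ uᶜ)
                 (solve 6 (λ A₁ A₂ B C β₁ β₂ → (A₁ ⊕ A₂) ⊕ (B ⊕ C) ⊕ β₁ ⊕ β₂ ⊜ (A₁ ⊕ A₂ ⊕ β₁) ⊕ B ⊕ C ⊕ β₂) ↭-refl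
                          (matching o a₁) (matching (o + size a₁) a₂) Mᵇ Mᶜ (bridge uᵃ¹ uᵃ²) (bridge uᵇ uᶜ)))
    where
    Mˢ Mᵃ Mᵇ Mᶜ : List Edge
    uᵃ uᵇ uᶜ uᵃ¹ uᵃ² : Maybe ℕ
    Mˢ = matching o s
    Mᵃ = matching (o + size s) a
    Mᵇ = matching (o + (size s + size a)) b
    Mᶜ = matching (o + (size s + size a) + size b) c
    uᵃ = unmatched (o + size s) a
    uᵇ = unmatched (o + (size s + size a)) b
    uᶜ = unmatched (o + (size s + size a) + size b) c
    uᵃ¹ = unmatched o a₁
    uᵃ² = unmatched (o + size a₁) a₂
  regroup : ∀ s a b c → (s + a) + (b + c) ≡ s + (a + b + c)
  regroup = solve-∀

joinLeft : ∀ d {h} (s : Tree h) (t : Tree (d + h)) → Joined (d + h) (2 * d) s t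
joinLeft zero s t = record { grown = two s t ; size-grown = refl ; edges-grown = λ _ → ≈-refl }
joinLeft (suc d) s (node2 a b)   = joinLeft-node2 a b (joinLeft d s a)
joinLeft (suc d) s (node3 a b c) = joinLeft-node3 a b c (joinLeft d s a)

data Compare : ℕ → ℕ → Set where
  taller  : ∀ d h → Compare (d + h) h
  shorter : ∀ d h → Compare h (suc d + h)

compareHeights : ∀ m n → Compare m n
compareHeights m n with n ≤? m
... | yes n≤m = subst (λ x → Compare x n) (m∸n+n≡m n≤m) (taller (m ∸ n) n)
... | no n≰m  =
  subst (Compare m) (trans (sym (+-suc (n ∸ suc m) m)) (m∸n+n≡m (≰⇒> n≰m))) (shorter (n ∸ suc m) m)

joinCost : ℕ → ℕ → ℕ
joinCost h₁ h₂ = 2 * (h₁ + h₂) + 1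

record Merged {h₁ h₂} (s : Tree h₁) (t : Tree h₂) : Set where
  field
    height     : ℕ
    tree       : Tree height
    height≤    : height ≤ suc (h₁ ⊔ h₂)
    size-tree  : size tree ≡ size s + size t
    -- t may sit at any offset o′ equal to o + size s, which spares callers rewriting sums of sizes.
    edges-tree : ∀ o o′ → o′ ≡ o + size s →
                 matching o s ++ matching o′ t ≈[ joinCost h₁ h₂ ] matching o tree

Joined⇒Merged : ∀ {h₁ h₂ h d} {s : Tree h₁} {t : Tree h₂} → h ≤ h₁ ⊔ h₂ → d ≤ h₁ + h₂ →
                Joined h (2 * d) s t → Merged s t
Joined⇒Merged {h = h} {d} h≤ d≤ record { grown = one x ; size-grown = size-x ; edges-grown = E } = record
  { height = h ; tree = x ; height≤ = m≤n⇒m≤1+n h≤ ; size-tree = size-x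
  ; edges-tree = λ { o _ refl → ≈-weaken (≤-trans (*-monoʳ-≤ 2 d≤) (m≤m+n _ 1)) (E o) } }
Joined⇒Merged {h = h} {d} h≤ d≤ record { grown = two x y ; size-grown = size-xy ; edges-grown = E } = record
  { height = suc h ; tree = node2 x y ; height≤ = s≤s h≤ ; size-tree = size-xy
  ; edges-tree = λ { o _ refl → ≈-weaken (+-monoˡ-≤ 1 (*-monoʳ-≤ 2 d≤)) (≈-trans (E o) (add-bridge o)) } }
  where
  add-bridge : ∀ o → matching₂ o x y ≈[ 1 ] matching o (node2 x y)
  add-bridge o = ≈-via-↭ ↭-refl (≈-++-short (length-bridge≤1 (unmatched o x) (unmatched (o + size x) y)))
                         (↭-reflexive (++-assoc (matching o x) _ _))

join : ∀ {h₁ h₂} (s : Tree h₁) (t : Tree h₂) → Merged s t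
join {h₁} {h₂} s t with compareHeights h₁ h₂
... | taller d h  =
  Joined⇒Merged (m≤m⊔n (d + h) h) (≤-trans (m≤m+n d h) (m≤m+n (d + h) h)) (joinRight d s t)
... | shorter d h =
  Joined⇒Merged (m≤n⊔m h (suc d + h)) (≤-trans (m≤m+n (suc d) h) (m≤n+m (suc d + h) h)) (joinLeft (suc d) s t)

-- Splitting

joinCost-mono : ∀ {L h₁ h₂} → h₁ ≤ L → h₂ ≤ L → joinCost h₁ h₂ ≤ joinCost L L
joinCost-mono h₁≤L h₂≤L = +-monoˡ-≤ 1 (*-monoʳ-≤ 2 (+-mono-≤ h₁≤L h₂≤L))

splitCost : ℕ → ℕ
splitCost H = 12 * (H * H)

splitCost-mono : ∀ {h L} → h ≤ L → splitCost h ≤ splitCost L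
splitCost-mono h≤L = *-monoʳ-≤ 12 (*-mono-≤ h≤L h≤L)

split-cost-step : ∀ H {c j₁ j₂} → c ≤ 2 → j₁ ≤ joinCost (suc H) (suc H) → j₂ ≤ joinCost (suc H) (suc H) →
                  splitCost H + c + (j₁ + j₂) ≤ splitCost (suc H)
split-cost-step H {c} {j₁} {j₂} c≤2 j₁≤ j₂≤ = begin
  splitCost H + c + (j₁ + j₂)                   ≤⟨ +-mono-≤ (+-monoʳ-≤ (splitCost H) c≤2) (+-mono-≤ j₁≤ j₂≤) ⟩
  splitCost H + 2 + (J + J)                     ≤⟨ m≤m+n _ (16 * H) ⟩
  splitCost H + 2 + (J + J) + 16 * H            ≡⟨ closed-form H ⟩
  splitCost (suc H)                             ∎
  where open ≤-Reasoning
        J : ℕ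
        J = joinCost (suc H) (suc H)
        closed-form : ∀ H → 12 * (H * H) + 2 + (2 * (suc H + suc H) + 1 + (2 * (suc H + suc H) + 1)) + 16 * H
                          ≡ 12 * (suc H * suc H)
        closed-form = solve-∀

small≤splitCost : ∀ H {c} → c ≤ 2 → c ≤ splitCost (suc H)
small≤splitCost H {c} c≤2 =
  ≤-trans (≤-trans (m≤n+m c (splitCost H)) (m≤m+n _ 0)) (split-cost-step H c≤2 z≤n z≤n)

record Split {H} (T : Tree H) (k : ℕ) : Set where
  field
    heightˡ heightʳ : ℕ
    treeˡ       : Tree heightˡ
    treeʳ       : Tree heightʳ
    heightˡ≤    : heightˡ ≤ suc H
    heightʳ≤    : heightʳ ≤ suc H
    size-treeˡ  : size treeˡ ≡ k
    size-split  : size treeˡ + size treeʳ ≡ size T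
    edges-split : ∀ o o′ → o′ ≡ o + size treeˡ →
                  matching o T ≈[ splitCost H ] matching o treeˡ ++ matching o′ treeʳ

offset-+ : ∀ o {x y z} → x + y ≡ z → o + x + y ≡ o + z
offset-+ o e = trans (+-assoc o _ _) (cong (o +_) e)

split₂-inLeft : ∀ {H k} {a b : Tree H} (S : Split a k) → Merged (Split.treeʳ S) b → Split (node2 a b) k
split₂-inLeft {H} {a = a} {b = b} S J = record
  { treeˡ = S.treeˡ ; treeʳ = J.tree
  ; heightˡ≤ = m≤n⇒m≤1+n S.heightˡ≤ ; heightʳ≤ = ≤-trans J.height≤ (s≤s (⊔-lub S.heightʳ≤ (n≤1+n H)))
  ; size-treeˡ = S.size-treeˡ
  ; size-split = trans (cong (size S.treeˡ +_) J.size-tree)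
                       (trans (sym (+-assoc (size S.treeˡ) _ _)) (cong (_+ size b) S.size-split))
  ; edges-split = edges }
  where
  module S = Split S
  module J = Merged J
  edges : ∀ o o′ → o′ ≡ o + size S.treeˡ →
          matching o (node2 a b) ≈[ splitCost (suc H) ] matching o S.treeˡ ++ matching o′ J.tree
  edges o _ refl =
    ≈-weaken (split-cost-step H (s≤s z≤n) z≤n (joinCost-mono S.heightʳ≤ (n≤1+n H)))
      (≈-trans (≈-replace {Y = Mᵇ} {B₂ = []} ↭-refl (S.edges-split o (o + size S.treeˡ) refl)
                          (length-bridge≤1 (unmatched o a) (unmatched (o + size a) b)) z≤n
                          (solve 3 (λ L R B → (L ⊕ R) ⊕ B ⊕ id ⊜ L ⊕ R ⊕ B) ↭-refl Mˡ Mʳ Mᵇ))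
               (≈-++ (≈-refl {Mˡ}) (J.edges-tree (o + size S.treeˡ) (o + size a) (sym (offset-+ o S.size-split)))))
    where
    Mˡ Mʳ Mᵇ : List Edge
    Mˡ = matching o S.treeˡ
    Mʳ = matching (o + size S.treeˡ) S.treeʳ
    Mᵇ = matching (o + size a) b

split₂-between : ∀ {H k} (a b : Tree H) → size a ≡ k → Split (node2 a b) k
split₂-between {H} a b size-a = record
  { treeˡ = a ; treeʳ = b
  ; heightˡ≤ = m≤n⇒m≤1+n (n≤1+n H) ; heightʳ≤ = m≤n⇒m≤1+n (n≤1+n H)
  ; size-treeˡ = size-a ; size-split = refl
  ; edges-split = λ { o _ refl → ≈-weaken (small≤splitCost H (s≤s z≤n))
      (≈-++ (≈-refl {matching o a})
            (≈-sym (≈-++-short (length-bridge≤1 (unmatched o a) (unmatched (o + size a) b))))) } }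

split₂-inRight : ∀ {H k} {a b : Tree H} → size a < k → (S : Split b (k ∸ size a)) → Merged a (Split.treeˡ S) →
                 Split (node2 a b) k
split₂-inRight {H} {a = a} {b = b} a<k S J = record
  { treeˡ = J.tree ; treeʳ = S.treeʳ
  ; heightˡ≤ = ≤-trans J.height≤ (s≤s (⊔-lub (n≤1+n H) S.heightˡ≤)) ; heightʳ≤ = m≤n⇒m≤1+n S.heightʳ≤
  ; size-treeˡ = trans J.size-tree (trans (cong (size a +_) S.size-treeˡ) (m+[n∸m]≡n (<⇒≤ a<k)))
  ; size-split = trans (cong (_+ size S.treeʳ) J.size-tree) (offset-+ (size a) S.size-split)
  ; edges-split = edges }
  where
  module S = Split S
  module J = Merged J
  edges : ∀ o o′ → o′ ≡ o + size J.tree →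
          matching o (node2 a b) ≈[ splitCost (suc H) ] matching o J.tree ++ matching o′ S.treeʳ
  edges o o′ o′≡ =
    ≈-weaken (split-cost-step H (s≤s z≤n) (joinCost-mono (n≤1+n H) S.heightˡ≤) z≤n)
      (≈-trans (≈-replace {Y = Mᵃ} {B₂ = []} (solve 3 (λ A B β → A ⊕ B ⊕ β ⊜ B ⊕ A ⊕ β) ↭-refl Mᵃ Mᵇ β)
                          (S.edges-split (o + size a) o′ o′≡o+a+l) (length-bridge≤1 uᵃ uᵇ) z≤n
                          (solve 3 (λ L R A → (L ⊕ R) ⊕ A ⊕ id ⊜ (A ⊕ L) ⊕ R) ↭-refl Mˡ Mʳ Mᵃ))
               (≈-++ (J.edges-tree o (o + size a) refl) (≈-refl {Mʳ})))
    where
    o′≡o+a+l : o′ ≡ o + size a + size S.treeˡ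
    o′≡o+a+l = trans o′≡ (trans (cong (o +_) J.size-tree) (sym (+-assoc o (size a) (size S.treeˡ))))
    Mᵃ Mᵇ Mˡ Mʳ β : List Edge
    uᵃ uᵇ : Maybe ℕ
    Mᵃ = matching o a
    Mᵇ = matching (o + size a) b
    Mˡ = matching (o + size a) S.treeˡ
    Mʳ = matching o′ S.treeʳ
    uᵃ = unmatched o a
    uᵇ = unmatched (o + size a) b
    β = bridge uᵃ uᵇ

split₃-inLeft : ∀ {H k} {a b c : Tree H} (S : Split a k) → Merged (Split.treeʳ S) (node2 b c) →
                Split (node3 a b c) k
split₃-inLeft {H} {a = a} {b = b} {c = c} S J = record
  { treeˡ = S.treeˡ ; treeʳ = J.tree
  ; heightˡ≤ = m≤n⇒m≤1+n S.heightˡ≤ ; heightʳ≤ = ≤-trans J.height≤ (s≤s (⊔-lub S.heightʳ≤ ≤-refl))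
  ; size-treeˡ = S.size-treeˡ
  ; size-split = trans (cong (size S.treeˡ +_) J.size-tree)
                       (trans (sym (+-assoc (size S.treeˡ) _ _))
                              (trans (cong (_+ (size b + size c)) S.size-split) (sym (+-assoc (size a) (size b) (size c)))))
  ; edges-split = edges }
  where
  module S = Split S
  module J = Merged J
  edges : ∀ o o′ → o′ ≡ o + size S.treeˡ →
          matching o (node3 a b c) ≈[ splitCost (suc H) ] matching o S.treeˡ ++ matching o′ J.tree
  edges o _ refl =
    ≈-weaken (split-cost-step H ≤-refl z≤n (joinCost-mono S.heightʳ≤ ≤-refl))
      (≈-trans (≈-replace {Y = Mᵇ ++ Mᶜ}
                          (solve 5 (λ A B C β₁ β₂ → (A ⊕ B ⊕ β₁) ⊕ C ⊕ β₂ ⊜ A ⊕ (B ⊕ C) ⊕ β₁ ⊕ β₂)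
                             ↭-refl Mᵃ Mᵇ Mᶜ β₁ β₂)
                          (S.edges-split o (o + size S.treeˡ) refl)
                          (length-bridges≤2 uᵃ uᵇ (leftover uᵃ uᵇ) uᶜ) (m≤n⇒m≤1+n (length-bridge≤1 uᵇ uᶜ))
                          (solve 5 (λ L R B C β → (L ⊕ R) ⊕ (B ⊕ C) ⊕ β ⊜ L ⊕ R ⊕ B ⊕ C ⊕ β)
                             ↭-refl Mˡ Mʳ Mᵇ Mᶜ (bridge uᵇ uᶜ)))
               (≈-++ (≈-refl {Mˡ}) (J.edges-tree (o + size S.treeˡ) (o + size a) (sym (offset-+ o S.size-split)))))
    where
    Mᵃ Mᵇ Mᶜ Mˡ Mʳ β₁ β₂ : List Edge
    uᵃ uᵇ uᶜ : Maybe ℕ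
    Mᵃ = matching o a
    Mᵇ = matching (o + size a) b
    Mᶜ = matching (o + size a + size b) c
    Mˡ = matching o S.treeˡ
    Mʳ = matching (o + size S.treeˡ) S.treeʳ
    uᵃ = unmatched o a
    uᵇ = unmatched (o + size a) b
    uᶜ = unmatched (o + size a + size b) c
    β₁ = bridge uᵃ uᵇ
    β₂ = bridge (leftover uᵃ uᵇ) uᶜ

split₃-afterLeft : ∀ {H k} (a b c : Tree H) → size a ≡ k → Split (node3 a b c) k
split₃-afterLeft {H} a b c size-a = record
  { treeˡ = a ; treeʳ = node2 b c
  ; heightˡ≤ = m≤n⇒m≤1+n (n≤1+n H) ; heightʳ≤ = n≤1+n (suc H)
  ; size-treeˡ = size-a ; size-split = sym (+-assoc (size a) (size b) (size c))
  ; edges-split = edges }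
  where
  edges : ∀ o o′ → o′ ≡ o + size a →
          matching o (node3 a b c) ≈[ splitCost (suc H) ] matching o a ++ matching o′ (node2 b c)
  edges o _ refl =
    ≈-weaken (small≤splitCost H ≤-refl)
      (≈-replace {Y = Mᵇ ++ Mᶜ}
                 (solve 5 (λ A B C β₁ β₂ → (A ⊕ B ⊕ β₁) ⊕ C ⊕ β₂ ⊜ A ⊕ (B ⊕ C) ⊕ β₁ ⊕ β₂) ↭-refl
                          Mᵃ Mᵇ Mᶜ (bridge uᵃ uᵇ) (bridge (leftover uᵃ uᵇ) uᶜ))
                 (≈-refl {Mᵃ}) (length-bridges≤2 uᵃ uᵇ (leftover uᵃ uᵇ) uᶜ) (m≤n⇒m≤1+n (length-bridge≤1 uᵇ uᶜ))
                 (solve 4 (λ A B C β → A ⊕ (B ⊕ C) ⊕ β ⊜ A ⊕ B ⊕ C ⊕ β) ↭-refl Mᵃ Mᵇ Mᶜ (bridge uᵇ uᶜ)))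
    where
    Mᵃ Mᵇ Mᶜ : List Edge
    uᵃ uᵇ uᶜ : Maybe ℕ
    Mᵃ = matching o a
    Mᵇ = matching (o + size a) b
    Mᶜ = matching (o + size a + size b) c
    uᵃ = unmatched o a
    uᵇ = unmatched (o + size a) b
    uᶜ = unmatched (o + size a + size b) c

split₃-inMiddle : ∀ {H k} {a b c : Tree H} → size a < k → (S : Split b (k ∸ size a)) →
                  Merged a (Split.treeˡ S) → Merged (Split.treeʳ S) c → Split (node3 a b c) k
split₃-inMiddle {H} {a = a} {b = b} {c = c} a<k S J₁ J₂ = record
  { treeˡ = J₁.tree ; treeʳ = J₂.tree
  ; heightˡ≤ = ≤-trans J₁.height≤ (s≤s (⊔-lub (n≤1+n H) S.heightˡ≤))
  ; heightʳ≤ = ≤-trans J₂.height≤ (s≤s (⊔-lub S.heightʳ≤ (n≤1+n H)))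
  ; size-treeˡ = trans J₁.size-tree (trans (cong (size a +_) S.size-treeˡ) (m+[n∸m]≡n (<⇒≤ a<k)))
  ; size-split = trans (cong₂ _+_ J₁.size-tree J₂.size-tree)
                       (trans (regroup (size a) (size S.treeˡ) (size S.treeʳ) (size c))
                              (cong (λ x → size a + x + size c) S.size-split))
  ; edges-split = edges }
  where
  module S = Split S
  module J₁ = Merged J₁
  module J₂ = Merged J₂
  regroup : ∀ a l r c → a + l + (r + c) ≡ a + (l + r) + c
  regroup = solve-∀
  edges : ∀ o o′ → o′ ≡ o + size J₁.tree →
          matching o (node3 a b c) ≈[ splitCost (suc H) ] matching o J₁.tree ++ matching o′ J₂.tree
  edges o o′ o′≡ =
    ≈-weaken (split-cost-step H ≤-refl (joinCost-mono (n≤1+n H) S.heightˡ≤) (joinCost-mono S.heightʳ≤ (n≤1+n H)))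
      (≈-trans (≈-replace {Y = Mᵃ ++ Mᶜ} {B₂ = []}
                          (solve 5 (λ A B C β₁ β₂ → (A ⊕ B ⊕ β₁) ⊕ C ⊕ β₂ ⊜ B ⊕ (A ⊕ C) ⊕ β₁ ⊕ β₂)
                             ↭-refl Mᵃ Mᵇ Mᶜ β₁ β₂)
                          (S.edges-split (o + size a) o′ o′≡o+a+l) (length-bridges≤2 uᵃ uᵇ (leftover uᵃ uᵇ) uᶜ) z≤n
                          (solve 4 (λ L R A C → (L ⊕ R) ⊕ (A ⊕ C) ⊕ id ⊜ (A ⊕ L) ⊕ R ⊕ C) ↭-refl Mˡ Mʳ Mᵃ Mᶜ))
               (≈-++ (J₁.edges-tree o (o + size a) refl) (J₂.edges-tree o′ (o + size a + size b) o+a+b≡o′+r)))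
    where
    o′≡o+a+l : o′ ≡ o + size a + size S.treeˡ
    o′≡o+a+l = trans o′≡ (trans (cong (o +_) J₁.size-tree) (sym (+-assoc o (size a) (size S.treeˡ))))
    o+a+b≡o′+r : o + size a + size b ≡ o′ + size S.treeʳ
    o+a+b≡o′+r = trans (sym (offset-+ (o + size a) S.size-split)) (cong (_+ size S.treeʳ) (sym o′≡o+a+l))
    Mᵃ Mᵇ Mᶜ Mˡ Mʳ β₁ β₂ : List Edge
    uᵃ uᵇ uᶜ : Maybe ℕ
    Mᵃ = matching o a
    Mᵇ = matching (o + size a) b
    Mᶜ = matching (o + size a + size b) c
    Mˡ = matching (o + size a) S.treeˡ
    Mʳ = matching o′ S.treeʳ
    uᵃ = unmatched o a
    uᵇ = unmatched (o + size a) b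
    uᶜ = unmatched (o + size a + size b) c
    β₁ = bridge uᵃ uᵇ
    β₂ = bridge (leftover uᵃ uᵇ) uᶜ

split₃-afterMiddle : ∀ {H k} (a b c : Tree H) → size a + size b ≡ k → Split (node3 a b c) k
split₃-afterMiddle {H} a b c size-ab = record
  { treeˡ = node2 a b ; treeʳ = c
  ; heightˡ≤ = n≤1+n (suc H) ; heightʳ≤ = m≤n⇒m≤1+n (n≤1+n H)
  ; size-treeˡ = size-ab ; size-split = refl
  ; edges-split = edges }
  where
  edges : ∀ o o′ → o′ ≡ o + size (node2 a b) →
          matching o (node3 a b c) ≈[ splitCost (suc H) ] matching o (node2 a b) ++ matching o′ c
  edges o o′ o′≡ rewrite o′≡ | sym (+-assoc o (size a) (size b)) =
    ≈-weaken (small≤splitCost H (s≤s z≤n))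
      (≈-++ (≈-refl {matching o (node2 a b)})
            (≈-sym (≈-++-short (length-bridge≤1 (unmatched o (node2 a b)) (unmatched (o + size a + size b) c)))))

split₃-inRight : ∀ {H k} {a b c : Tree H} → size a + size b < k → (S : Split c (k ∸ (size a + size b))) →
                 Merged (node2 a b) (Split.treeˡ S) → Split (node3 a b c) k
split₃-inRight {H} {a = a} {b = b} {c = c} ab<k S J = record
  { treeˡ = J.tree ; treeʳ = S.treeʳ
  ; heightˡ≤ = ≤-trans J.height≤ (s≤s (⊔-lub ≤-refl S.heightˡ≤)) ; heightʳ≤ = m≤n⇒m≤1+n S.heightʳ≤
  ; size-treeˡ = trans J.size-tree (trans (cong (size a + size b +_) S.size-treeˡ) (m+[n∸m]≡n (<⇒≤ ab<k)))
  ; size-split = trans (cong (_+ size S.treeʳ) J.size-tree) (offset-+ (size a + size b) S.size-split)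
  ; edges-split = edges }
  where
  module S = Split S
  module J = Merged J
  edges : ∀ o o′ → o′ ≡ o + size J.tree →
          matching o (node3 a b c) ≈[ splitCost (suc H) ] matching o J.tree ++ matching o′ S.treeʳ
  edges o o′ o′≡ =
    ≈-weaken (split-cost-step H (s≤s z≤n) (joinCost-mono ≤-refl S.heightˡ≤) z≤n)
      (≈-trans (≈-replace {Y = Mᵃᵇ} {B₂ = []} (solve 3 (λ P C β → P ⊕ C ⊕ β ⊜ C ⊕ P ⊕ β) ↭-refl Mᵃᵇ Mᶜ β)
                          (S.edges-split (o + size a + size b) o′ o′≡o+a+b+l)
                          (length-bridge≤1 (unmatched o (node2 a b)) (unmatched (o + size a + size b) c)) z≤n
                          (solve 3 (λ L R P → (L ⊕ R) ⊕ P ⊕ id ⊜ (P ⊕ L) ⊕ R) ↭-refl Mˡ Mʳ Mᵃᵇ))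
               (≈-++ (J.edges-tree o (o + size a + size b) (+-assoc o (size a) (size b))) (≈-refl {Mʳ})))
    where
    regroup : ∀ o a b l → o + (a + b + l) ≡ o + a + b + l
    regroup = solve-∀
    o′≡o+a+b+l : o′ ≡ o + size a + size b + size S.treeˡ
    o′≡o+a+b+l = trans o′≡ (trans (cong (o +_) J.size-tree) (regroup o (size a) (size b) (size S.treeˡ)))
    Mᵃᵇ Mᶜ Mˡ Mʳ β : List Edge
    Mᵃᵇ = matching o (node2 a b)
    Mᶜ = matching (o + size a + size b) c
    Mˡ = matching (o + size a + size b) S.treeˡ
    Mʳ = matching o′ S.treeʳ
    β = bridge (unmatched o (node2 a b)) (unmatched (o + size a + size b) c)

∸-<-cancel : ∀ {m k n} → m < k → k < m + n → k ∸ m < n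
∸-<-cancel {m} {k} {n} m<k k<m+n = subst (k ∸ m <_) (m+n∸m≡n m n) (∸-monoˡ-< k<m+n (<⇒≤ m<k))

split : ∀ {H} (T : Tree H) k → 1 ≤ k → k < size T → Split T k
split leaf k 1≤k k<1 = ⊥-elim (<⇒≱ k<1 1≤k)
split (node2 a b) k 1≤k k<T with <-cmp k (size a)
... | tri< k<a _ _ = let Sa = split a k 1≤k k<a in split₂-inLeft Sa (join (Split.treeʳ Sa) b)
... | tri≈ _ k≡a _ = split₂-between a b (sym k≡a)
... | tri> _ _ a<k =
  let Sb = split b (k ∸ size a) (m<n⇒0<n∸m a<k) (∸-<-cancel a<k k<T) in
  split₂-inRight a<k Sb (join a (Split.treeˡ Sb))
split (node3 a b c) k 1≤k k<T with <-cmp k (size a)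
... | tri< k<a _ _ = let Sa = split a k 1≤k k<a in split₃-inLeft Sa (join (Split.treeʳ Sa) (node2 b c))
... | tri≈ _ k≡a _ = split₃-afterLeft a b c (sym k≡a)
... | tri> _ _ a<k with <-cmp k (size a + size b)
...   | tri< k<ab _ _ =
  let Sb = split b (k ∸ size a) (m<n⇒0<n∸m a<k) (∸-<-cancel a<k k<ab) in
  split₃-inMiddle a<k Sb (join a (Split.treeˡ Sb)) (join (Split.treeʳ Sb) c)
...   | tri≈ _ k≡ab _ = split₃-afterMiddle a b c (sym k≡ab)
...   | tri> _ _ ab<k =
  let Sc = split c (k ∸ (size a + size b)) (m<n⇒0<n∸m ab<k) (∸-<-cancel ab<k k<T) in
  split₃-inRight ab<k Sc (join (node2 a b) (Split.treeˡ Sc))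

2^height≤size : ∀ {h} (t : Tree h) → 2 ^ h ≤ size t
2^height≤size leaf = ≤-refl
2^height≤size {suc h} (node2 a b) =
  ≤-trans (≤-reflexive (cong (2 ^ h +_) (+-identityʳ (2 ^ h)))) (+-mono-≤ (2^height≤size a) (2^height≤size b))
2^height≤size {suc h} (node3 a b c) =
  ≤-trans (≤-trans (≤-reflexive (cong (2 ^ h +_) (+-identityʳ (2 ^ h)))) (+-mono-≤ (2^height≤size a) (2^height≤size b)))
          (m≤m+n (size a + size b) (size c))

height≤log₂size : ∀ {h} (t : Tree h) → h ≤ ⌊log₂ size t ⌋
height≤log₂size {h} t = subst (_≤ ⌊log₂ size t ⌋) (⌊log₂[2^n]⌋≡n h) (⌊log₂⌋-mono-≤ (2^height≤size t))

Disjoint⇒Unique : ∀ {M} → AllPairs Disjoint M → Unique M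
Disjoint⇒Unique = AllPairs.map λ { (a≢c , _) refl → a≢c refl }

matching-unique : ∀ {h} o (t : Tree h) → Unique (matching o t)
matching-unique o t = Disjoint⇒Unique (Valid.disjoint (tree-valid o t))

matching₂-unique : ∀ {h₁ h₂} o (s : Tree h₁) (t : Tree h₂) → Unique (matching₂ o s t)
matching₂-unique {h₁} {h₂} o s t = Disjoint⇒Unique (AllPairsₚ.++⁺ (Valid.disjoint Vˢ) (Valid.disjoint Vᵗ) separated)
  where
  Vˢ : Valid o (o + size s) (h₁ + h₁) (matching o s) (unmatched o s)
  Vˢ = tree-valid o s
  Vᵗ : Valid (o + size s) (o + size s + size t) (h₂ + h₂) (matching (o + size s) t) (unmatched (o + size s) t)
  Vᵗ = tree-valid (o + size s) t
  separated : All (λ e → All (Disjoint e) (matching (o + size s) t)) (matching o s)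
  separated = All.tabulate λ {e} e∈ → All.tabulate λ {f} f∈ →
    let (mid<c , c<d , _) = All.lookup (Valid.inRange Vᵗ) f∈ in
    separated⇒Disjoint e f (All.lookup (Valid.inRange Vˢ) e∈) mid<c c<d

Coverage⇒NearPerfect : ∀ {n M} u → Coverage 0 n M u → NearPerfect n M
Coverage⇒NearPerfect nothing covered u v 1≤u u≤n _ _ u-free _ = ⊥-elim (u-free (covered u 1≤u u≤n))
Coverage⇒NearPerfect (just w) (_ , _ , others , _) u v 1≤u u≤n 1≤v v≤n u-free v-free with u ≟ w | v ≟ w
... | yes refl | yes refl = refl
... | no u≢w   | _        = ⊥-elim (u-free (others u 1≤u u≤n u≢w))
... | _        | no v≢w   = ⊥-elim (v-free (others v 1≤v v≤n v≢w))

tree-matching-properties : ∀ {h} (t : Tree h) → let n = size t ; M = matching 0 t in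
  IsMatching n M × NearPerfect n M × Laminar M × DepthAtMost (24 * (1 + ⌊log₂ n ⌋)) M
tree-matching-properties t =
  (inRange , disjoint) , Coverage⇒NearPerfect (unmatched 0 t) coverage , laminar ,
  λ C C⊆M nested → ≤-trans (Ranked⇒DepthAtMost ranked C C⊆M nested) (depth-bound (height≤log₂size t))
  where
  open Valid (tree-valid 0 t)
  depth-bound : ∀ {h L} → h ≤ L → h + h ≤ 24 * (1 + L)
  depth-bound {L = L} h≤L =
    ≤-trans (+-mono-≤ h≤L h≤L) (≤-trans (m≤m+n (L + L) (22 * L + 24)) (≤-reflexive (closed-form L)))
    where closed-form : ∀ L → L + L + (22 * L + 24) ≡ 24 * (1 + L)
          closed-form = solve-∀

join-modified : ∀ {h₁ h₂} (s : Tree h₁) (t : Tree h₂) →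
  modified (matching 0 s ++ shift (size s) (matching 0 t)) (matching 0 (Merged.tree (join s t)))
    ≤ 24 * (1 + ⌊log₂ (size s + size t) ⌋)
join-modified {h₁} {h₂} s t rewrite sym (matching-shift (size s) t) =
  ≤-trans (modified≤ (matching₂-unique 0 s t) (matching-unique 0 J.tree) (J.edges-tree 0 (size s) refl))
          (merge-bound (≤-trans (height≤log₂size s) (⌊log₂⌋-mono-≤ (m≤m+n (size s) (size t))))
                       (≤-trans (height≤log₂size t) (⌊log₂⌋-mono-≤ (m≤n+m (size t) (size s)))))
  where
  module J = Merged (join s t)
  merge-bound : ∀ {L} → h₁ ≤ L → h₂ ≤ L → joinCost h₁ h₂ + joinCost h₁ h₂ ≤ 24 * (1 + L)
  merge-bound {L} h₁≤L h₂≤L =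
    ≤-trans (+-mono-≤ (joinCost-mono h₁≤L h₂≤L) (joinCost-mono h₁≤L h₂≤L))
            (≤-trans (m≤m+n _ (16 * L + 22)) (≤-reflexive (closed-form L)))
    where closed-form : ∀ L → 2 * (L + L) + 1 + (2 * (L + L) + 1) + (16 * L + 22) ≡ 24 * (1 + L)
          closed-form = solve-∀

split-modified : ∀ {h} (t : Tree h) k (1≤k : 1 ≤ k) (k<n : k < size t) → let S = split t k 1≤k k<n in
  modified (matching 0 t) (matching 0 (Split.treeˡ S) ++ shift k (matching 0 (Split.treeʳ S)))
    ≤ 24 * ((1 + ⌊log₂ size t ⌋) * (1 + ⌊log₂ size t ⌋))
split-modified {h} t k 1≤k k<n rewrite sym (matching-shift k (Split.treeʳ (split t k 1≤k k<n))) =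
  ≤-trans (modified≤ (matching-unique 0 t) (subst (λ o → Unique (matching 0 S.treeˡ ++ matching o S.treeʳ)) S.size-treeˡ
                                                   (matching₂-unique 0 S.treeˡ S.treeʳ))
                     (S.edges-split 0 k (sym S.size-treeˡ)))
          (split-bound (m≤n⇒m≤1+n (height≤log₂size t)))
  where
  module S = Split (split t k 1≤k k<n)
  split-bound : ∀ {L} → h ≤ L → splitCost h + splitCost h ≤ 24 * (L * L)
  split-bound {L} h≤L =
    ≤-trans (+-mono-≤ (splitCost-mono h≤L) (splitCost-mono h≤L)) (≤-reflexive (closed-form L))
    where closed-form : ∀ L → 12 * (L * L) + 12 * (L * L) ≡ 24 * (L * L)
          closed-form = solve-∀

treeStructure : DataStructure
treeStructure = record
  { State = Σ ℕ Tree
  ; size = λ s → size (proj₂ s)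
  ; matching = λ s → matching 0 (proj₂ s)
  ; create = 0 , leaf
  ; size-create = refl
  ; merge = λ s t → let J = join (proj₂ s) (proj₂ t) in Merged.height J , Merged.tree J
  ; size-merge = λ s t → Merged.size-tree (join (proj₂ s) (proj₂ t))
  ; split = λ s k 1≤k k<n → let S = split (proj₂ s) k 1≤k k<n in
                            (Split.heightˡ S , Split.treeˡ S) , (Split.heightʳ S , Split.treeʳ S)
  ; size-split₁ = λ s k 1≤k k<n → Split.size-treeˡ (split (proj₂ s) k 1≤k k<n)
  ; size-split₂ = λ s k 1≤k k<n → let open Split (split (proj₂ s) k 1≤k k<n) in
      trans (sym (m+n∸m≡n (size treeˡ) (size treeʳ))) (cong₂ _∸_ size-split size-treeˡ)
  }

lemma7p3 : Σ DataStructure (λ D → Σ ℕ (λ c → Guarantees D c))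
lemma7p3 = treeStructure , 24 ,
  (λ s → tree-matching-properties (proj₂ s)) ,
  (λ s t → join-modified (proj₂ s) (proj₂ t)) ,
  (λ s → split-modified (proj₂ s))
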